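{- Let $q$ be an odd prime power and let \[ f(X)=aX+\frac{1}{X-r}+\frac{1}{X+r}\in\mathbb{F}_q(X), \] where $a\in\mathbb{F}_q^*$, $r\in\mathbb{F}_{q^2}\setminus\mathbb{F}_q$ and $r^2\in\mathbb{F}_q$. Then $f$ is a permutation rational function of $\mathbb{P}^1(\mathbb{F}_q)$ if and only if $a=-1/(4r^2)$.
   Context: $\mathbb{P}^1(\mathbb{F}_q)=\mathbb{F}_q\cup\{\infty\}$ is the projective line over $\mathbb{F}_q$. A rational function $f=P/Q\in\mathbb{F}_q(X)$ ($P,Q$ coprime) defines a map $\mathbb{P}^1(\mathbb{F}_q)\to\mathbb{P}^1(\mathbb{F}_q)$ in the usual way (zeros of $Q$ map to $\infty$, and $f(\infty)$ is the limiting value). A permutation rational function of $\mathbb{P}^1(\mathbb{F}_q)$ is a rational function whose induced map on $\mathbb{P}^1(\mathbb{F}_q)$ is a bijection. -}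

module Defs where

open import Data.Nat using (ℕ)
open import Data.Fin using (Fin)
open import Data.List using (List; []; _∷_; reverse; length; map)
open import Data.Maybe using (Maybe; just; nothing)
import Data.Maybe as Maybe
open import Data.Product using (Σ; _×_)
open import Data.Bool using (if_then_else_)
open import Relation.Binary.PropositionalEquality using (_≡_; _≢_)
open import Relation.Binary.Definitions using (DecidableEquality)
open import Relation.Nullary using (yes; no)
open import Algebra.Structures using (IsCommutativeRing)
open import Function.Bundles using (_↔_)
open import Function.Definitions using (Bijective)
import Data.Nat as ℕ

-- Fields (with propositional equality).  The inverse is a total
-- operation; only its values on nonzero elements are constrained
-- (plus the harmless convention 0⁻¹ = 0).

record Field : Set₁ where
  infixl 7 _*_
  infixl 6 _+_
  field
    Carrier    : Set
    0# 1#      : Carrier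
    _+_ _*_    : Carrier → Carrier → Carrier
    -_         : Carrier → Carrier
    _⁻¹        : Carrier → Carrier
    _≟_        : DecidableEquality Carrier
    isCommutativeRing : IsCommutativeRing _≡_ _+_ _*_ -_ 0# 1#
    0≢1        : 0# ≢ 1#
    ⁻¹-inverse : ∀ x → x ≢ 0# → x * (x ⁻¹) ≡ 1#
    ⁻¹-zero    : 0# ⁻¹ ≡ 0#

record FiniteField (q : ℕ) : Set₁ where
  field
    field′      : Field
  open Field field′ public
  field
    cardinality : Carrier ↔ Fin q

-- A field embedding K ↪ L (a unital ring homomorphism; injective
-- automatically since K is a field).
record Embedding {q₁ q₂ : ℕ} (K : FiniteField q₁) (L : FiniteField q₂) : Set where
  private
    module K = FiniteField K
    module L = FiniteField L
  field
    ι     : K.Carrier → L.Carrier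
    ι-+   : ∀ x y → ι (x K.+ y) ≡ ι x L.+ ι y
    ι-*   : ∀ x y → ι (x K.* y) ≡ ι x L.* ι y
    ι-1   : ι K.1# ≡ L.1#

P¹ : Set → Set
P¹ A = Maybe A

∞ : {A : Set} → P¹ A
∞ = nothing

-- Polynomials over a field F as coefficient lists, constant term first.

module Poly (F : Field) where
  open Field F

  Pol : Set
  Pol = List Carrier

  const : Carrier → Pol
  const c = c ∷ []

  Xₚ : Pol
  Xₚ = 0# ∷ 1# ∷ []

  infixl 6 _+ₚ_
  infixl 7 _*ₚ_

  _+ₚ_ : Pol → Pol → Pol
  []      +ₚ q       = q
  (a ∷ p) +ₚ []      = a ∷ p
  (a ∷ p) +ₚ (b ∷ q) = (a + b) ∷ (p +ₚ q)

  _*ₚ_ : Pol → Pol → Pol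
  []      *ₚ q = []
  (a ∷ p) *ₚ q = map (a *_) q +ₚ (0# ∷ (p *ₚ q))

  eval : Pol → Carrier → Carrier
  eval []      x = 0#
  eval (a ∷ p) x = a + x * eval p x

  dropZeros : List Carrier → List Carrier
  dropZeros []      = []
  dropZeros (c ∷ cs) with c ≟ 0#
  ... | yes _ = dropZeros cs
  ... | no  _ = c ∷ cs

  topCoeffs : Pol → List Carrier
  topCoeffs p = dropZeros (reverse p)

  -- number of coefficients = degree + 1 (0 for the zero polynomial)
  size : Pol → ℕ
  size p = length (topCoeffs p)

  lead : Pol → Carrier
  lead p with topCoeffs p
  ... | []    = 0#
  ... | c ∷ _ = c

  -- The map P¹(F) → P¹(F) induced by the rational function P/Q
  -- (P, Q coprime, Q ≠ 0), in the usual way: zeros of Q go to ∞, and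
  -- f(∞) is the limiting value determined by the degrees / leading
  -- coefficients.
  evalRat : Pol → Pol → P¹ Carrier → P¹ Carrier
  evalRat P Q (just x) with eval Q x ≟ 0#
  ... | yes _ = ∞
  ... | no  _ = just (eval P x * (eval Q x) ⁻¹)
  evalRat P Q nothing =
    if size Q ℕ.<ᵇ size P then ∞
    else (if size P ℕ.<ᵇ size Q then just 0#
          else just (lead P * (lead Q) ⁻¹))

-- The rational function of Theorem 3.4,
--   f(X) = aX + 1/(X - r) + 1/(X + r),
-- written as P/Q with Q = (X - r)(X + r) and
-- P = aX(X - r)(X + r) + (X + r) + (X - r), with coefficients taken in
-- the extension L ⊇ K (r ∈ L).  P and Q are coprime (P(±r) = ±2r ≠ 0).

module ThmDefs {q : ℕ} (K : FiniteField q) (L : FiniteField (q ℕ.* q))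
               (emb : Embedding K L) where
  private
    module K = FiniteField K
    module L = FiniteField L
  open Embedding emb
  open Poly L.field′

  fDen : L.Carrier → Pol
  fDen r = (L.- r ∷ L.1# ∷ []) *ₚ (r ∷ L.1# ∷ [])

  fNum : K.Carrier → L.Carrier → Pol
  fNum a r = const (ι a) *ₚ Xₚ *ₚ fDen r +ₚ (r ∷ L.1# ∷ []) +ₚ (L.- r ∷ L.1# ∷ [])

  ιP¹ : P¹ K.Carrier → P¹ L.Carrier
  ιP¹ = Maybe.map ι

  -- A map φ on P¹(L) (coming from a rational function with coefficients
  -- in K) is a permutation rational function of P¹(K) if it induces a
  -- map g : P¹(K) → P¹(K) (i.e. φ ∘ ι = ι ∘ g) and g is a bijection.
  IsPermutationOfP¹K : (P¹ L.Carrier → P¹ L.Carrier) → Set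
  IsPermutationOfP¹K φ =
    Σ (P¹ K.Carrier → P¹ K.Carrier) λ g →
      (∀ x → φ (ιP¹ x) ≡ ιP¹ (g x)) × Bijective _≡_ _≡_ g

  f : K.Carrier → L.Carrier → P¹ L.Carrier → P¹ L.Carrier
  f a r = evalRat (fNum a r) (fDen r)

  four : L.Carrier
  four = L.1# L.+ L.1# L.+ L.1# L.+ L.1#

module Submission where

-- Since s is a nonsquare in K, on K the map is h_a(x) = ax + 2x/(x² - s),
-- and f(∞) = ∞; so f permutes P¹(K) iff h_a is injective on K.
--  * If 4as = -1, a collision h_a(x) = h_a(y), x ≠ y, forces
--    (xy + 3s)² = s(x - y)², making s a square (QuadraticMap).
--  * If h_a is injective then Σ h_a(x)² = Σ x² over K.  Expanding h_a²
--    reduces this to a linear relation in T₁ = Σ 1/(x² - s) and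
--    T₂ = Σ 1/(x² - s)², which are computed by reindexing the sums along
--    x ↦ s/x and x ↦ (x + s)/(x + 1): 2sT₁ = -1 and 8s²T₂ = 3.  The
--    relation then reads 4as = -1 (PowerSums).

open import Defs
open import Level using (0ℓ)
open import Algebra.Bundles using (CommutativeRing)
open import Algebra.Solver.Ring.AlmostCommutativeRing
  using (fromCommutativeRing; _-Raw-AlmostCommutative⟶_)
open import Data.Nat as ℕ using (ℕ; zero; suc; _^_; _≤_)
import Data.Nat.Properties as ℕ
open import Data.Nat.Divisibility using (_∣_; divides; ∣1⇒≡1; ∣m∣n⇒∣m+n; ∣-refl)
open import Data.Nat.Primality using (Prime; euclidsLemma; prime[2])
open import Data.Integer as ℤ using (ℤ; -[1+_])
open import Data.Integer.Base using (+-*-rawRing)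
import Data.Integer.Properties as ℤ
open import Data.Sign as Sign using (Sign)
open import Data.Empty using (⊥-elim)
open import Data.Sum using (_⊎_; inj₁; inj₂)
import Data.Sum as Sum
open import Data.Product using (∃; _,_; proj₁; proj₂)
open import Data.Maybe using (Maybe; just; nothing)
import Data.Maybe as Maybe
open import Data.Maybe.Properties using (just-injective)
open import Data.List using ([]; _∷_; length; map)
open import Data.Fin as Fin using (Fin; punchOut)
import Data.Fin.Properties as Fin
open import Data.Fin.Permutation using (Permutation; _⟨$⟩ˡ_)
open import Function using (_∘_)
open import Function.Bundles using (_↔_; _⇔_; Inverse; mk↔ₛ′; mk⇔)
open import Function.Construct.Composition using (_⇔-∘_)
open import Function.Definitions using (Injective; Surjective)
open import Relation.Nullary using (¬_; yes; no)
open import Relation.Binary.PropositionalEquality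

-- Every field receives the ring homomorphism ℤ → F, which lets us use the
-- standard ring solver with integer coefficients on field expressions.
module FieldSolver (F : Field) where
  commutativeRing : CommutativeRing 0ℓ 0ℓ
  commutativeRing = record { isCommutativeRing = Field.isCommutativeRing F }

  open CommutativeRing commutativeRing public hiding (sym; trans; refl; zero)
  open import Algebra.Properties.Ring ring public
    using (-1*x≈-x; -‿distribʳ-*; -‿involutive; -‿anti-homo-+; -0#≈0#)
  open import Algebra.Properties.Semiring.Mult.TCOptimised semiring public
    using (_×_; ×-homo-+; ×1-homo-*; ×ᵤ≈×)
  open ≡-Reasoning

  nat : ℕ → Carrier
  nat n = n × 1#

  int : ℤ → Carrier
  int (ℤ.+ n)    = nat n
  int -[1+ n ] = - nat (suc n)

  nat-suc : ∀ n → nat (suc n) ≡ 1# + nat n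
  nat-suc n = ×-homo-+ 1# 1 n

  neg-+ : ∀ a b → - (a + b) ≡ - a + - b
  neg-+ a b = trans (cong -_ (+-comm a b)) (-‿anti-homo-+ b a)

  private
    sgn : Sign → Carrier
    sgn Sign.+ = 1#
    sgn Sign.- = - 1#

    sgn-* : ∀ s t → sgn (s Sign.* t) ≡ sgn s * sgn t
    sgn-* Sign.+ t      = sym (*-identityˡ _)
    sgn-* Sign.- Sign.+ = sym (*-identityʳ _)
    sgn-* Sign.- Sign.- = begin
      1#              ≡⟨ sym (-‿involutive _) ⟩
      - - 1#          ≡⟨ cong -_ (sym (-1*x≈-x _)) ⟩
      - (- 1# * 1#)   ≡⟨ -‿distribʳ-* _ _ ⟩
      - 1# * - 1#     ∎

    int-◃ : ∀ s n → int (s ℤ.◃ n) ≡ sgn s * nat n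
    int-◃ s      zero    = sym (zeroʳ _)
    int-◃ Sign.+ (suc n) = sym (*-identityˡ _)
    int-◃ Sign.- (suc n) = sym (-1*x≈-x _)

    int-sign-abs : ∀ i → int i ≡ sgn (ℤ.sign i) * nat ℤ.∣ i ∣
    int-sign-abs (ℤ.+ n)    = sym (*-identityˡ _)
    int-sign-abs -[1+ n ] = sym (-1*x≈-x _)

    int-⊖ : ∀ m n → int (m ℤ.⊖ n) ≡ nat m + - nat n
    int-⊖ m zero = begin
      int (m ℤ.⊖ 0)  ≡⟨ cong int (ℤ.⊖-≥ {m} {0} ℕ.z≤n) ⟩
      nat m          ≡⟨ sym (+-identityʳ _) ⟩
      nat m + 0#     ≡⟨ cong (nat m +_) (sym -0#≈0#) ⟩
      nat m + - 0#   ∎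
    int-⊖ zero (suc n) = begin
      int (0 ℤ.⊖ suc n)   ≡⟨ cong int (ℤ.⊖-< {0} {suc n} (ℕ.s≤s ℕ.z≤n)) ⟩
      - nat (suc n)       ≡⟨ sym (+-identityˡ _) ⟩
      0# + - nat (suc n)  ∎
    int-⊖ (suc m) (suc n) = begin
      int (suc m ℤ.⊖ suc n)              ≡⟨ cong int (ℤ.[1+m]⊖[1+n]≡m⊖n m n) ⟩
      int (m ℤ.⊖ n)                      ≡⟨ int-⊖ m n ⟩
      nat m + - nat n                    ≡⟨ shift (nat m) (nat n) ⟩
      (1# + nat m) + (- 1# + - nat n)    ≡⟨ cong ((1# + nat m) +_) (sym (neg-+ 1# (nat n))) ⟩
      (1# + nat m) + - (1# + nat n)      ≡⟨ cong₂ (λ u v → u + - v) (sym (nat-suc m)) (sym (nat-suc n)) ⟩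
      nat (suc m) + - nat (suc n)        ∎
      where
      shift : ∀ x y → x + - y ≡ (1# + x) + (- 1# + - y)
      shift x y = begin
        x + - y                       ≡⟨ sym (+-identityˡ _) ⟩
        0# + (x + - y)                ≡⟨ cong (_+ (x + - y)) (sym (-‿inverseʳ 1#)) ⟩
        (1# + - 1#) + (x + - y)       ≡⟨ +-assoc _ _ _ ⟩
        1# + (- 1# + (x + - y))       ≡⟨ cong (1# +_) (sym (+-assoc _ _ _)) ⟩
        1# + ((- 1# + x) + - y)       ≡⟨ cong (λ z → 1# + (z + - y)) (+-comm _ _) ⟩
        1# + ((x + - 1#) + - y)       ≡⟨ cong (1# +_) (+-assoc _ _ _) ⟩
        1# + (x + (- 1# + - y))       ≡⟨ sym (+-assoc _ _ _) ⟩
        (1# + x) + (- 1# + - y)       ∎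

  int-+ : ∀ i j → int (i ℤ.+ j) ≡ int i + int j
  int-+ -[1+ m ] -[1+ n ] = begin
    - nat (suc (suc (m ℕ.+ n)))        ≡⟨ cong (λ z → - nat (suc z)) (sym (ℕ.+-suc m n)) ⟩
    - nat (suc m ℕ.+ suc n)            ≡⟨ cong -_ (×-homo-+ 1# (suc m) (suc n)) ⟩
    - (nat (suc m) + nat (suc n))      ≡⟨ neg-+ _ _ ⟩
    - nat (suc m) + - nat (suc n)      ∎
  int-+ -[1+ m ] (ℤ.+ n)    = trans (int-⊖ n (suc m)) (+-comm _ _)
  int-+ (ℤ.+ m)    -[1+ n ] = int-⊖ m (suc n)
  int-+ (ℤ.+ m)    (ℤ.+ n)    = ×-homo-+ 1# m n

  int-* : ∀ i j → int (i ℤ.* j) ≡ int i * int j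
  int-* i j = begin
    int (ℤ.sign i Sign.* ℤ.sign j ℤ.◃ ℤ.∣ i ∣ ℕ.* ℤ.∣ j ∣)
      ≡⟨ int-◃ (ℤ.sign i Sign.* ℤ.sign j) (ℤ.∣ i ∣ ℕ.* ℤ.∣ j ∣) ⟩
    sgn (ℤ.sign i Sign.* ℤ.sign j) * nat (ℤ.∣ i ∣ ℕ.* ℤ.∣ j ∣)
      ≡⟨ cong₂ _*_ (sgn-* (ℤ.sign i) (ℤ.sign j)) (×1-homo-* ℤ.∣ i ∣ ℤ.∣ j ∣) ⟩
    (sgn (ℤ.sign i) * sgn (ℤ.sign j)) * (nat ℤ.∣ i ∣ * nat ℤ.∣ j ∣)
      ≡⟨ interchange _ _ _ _ ⟩
    (sgn (ℤ.sign i) * nat ℤ.∣ i ∣) * (sgn (ℤ.sign j) * nat ℤ.∣ j ∣)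
      ≡⟨ cong₂ _*_ (sym (int-sign-abs i)) (sym (int-sign-abs j)) ⟩
    int i * int j ∎
    where
    interchange : ∀ a b c d → (a * b) * (c * d) ≡ (a * c) * (b * d)
    interchange a b c d = begin
      (a * b) * (c * d)   ≡⟨ *-assoc _ _ _ ⟩
      a * (b * (c * d))   ≡⟨ cong (a *_) (sym (*-assoc _ _ _)) ⟩
      a * ((b * c) * d)   ≡⟨ cong (λ z → a * (z * d)) (*-comm _ _) ⟩
      a * ((c * b) * d)   ≡⟨ cong (a *_) (*-assoc _ _ _) ⟩
      a * (c * (b * d))   ≡⟨ sym (*-assoc _ _ _) ⟩
      (a * c) * (b * d)   ∎

  int-neg : ∀ i → int (ℤ.- i) ≡ - int i
  int-neg (ℤ.+ zero)  = sym -0#≈0#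
  int-neg (ℤ.+ suc n) = refl
  int-neg -[1+ n ]  = sym (-‿involutive _)

  ℤ-homomorphism : +-*-rawRing -Raw-AlmostCommutative⟶ fromCommutativeRing commutativeRing
  ℤ-homomorphism = record
    { ⟦_⟧ = int ; +-homo = int-+ ; *-homo = int-* ; -‿homo = int-neg
    ; 0-homo = refl ; 1-homo = refl }

  private
    int-≟ : ∀ x y → Maybe (int x ≡ int y)
    int-≟ x y with x ℤ.≟ y
    ... | yes p = just (cong int p)
    ... | no _  = nothing

  open import Algebra.Solver.Ring +-*-rawRing (fromCommutativeRing commutativeRing)
    ℤ-homomorphism int-≟ public

module FieldFacts (F : Field) where
  open FieldSolver F public
  open Field F public using (_⁻¹; _≟_; 0≢1; ⁻¹-inverse; ⁻¹-zero)
  open ≡-Reasoning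

  1≢0 : 1# ≢ 0#
  1≢0 eq = 0≢1 (sym eq)

  x⁻¹*x≡1 : ∀ {x} → x ≢ 0# → x ⁻¹ * x ≡ 1#
  x⁻¹*x≡1 {x} x≢0 = trans (*-comm _ _) (⁻¹-inverse x x≢0)

  x-y≡0⇒x≡y : ∀ {x y} → x + - y ≡ 0# → x ≡ y
  x-y≡0⇒x≡y {x} {y} eq = begin
    x               ≡⟨ solve 2 (λ a b → a := (a :- b) :+ b) refl x y ⟩
    (x + - y) + y   ≡⟨ cong (_+ y) eq ⟩
    0# + y          ≡⟨ +-identityˡ y ⟩
    y               ∎

  x≡y⇒x-y≡0 : ∀ {x y} → x ≡ y → x + - y ≡ 0#
  x≡y⇒x-y≡0 {x} refl = -‿inverseʳ x

  *-cancelˡ : ∀ {c x y} → c ≢ 0# → c * x ≡ c * y → x ≡ y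
  *-cancelˡ {c} {x} {y} c≢0 eq = begin
    x                ≡⟨ sym (*-identityˡ x) ⟩
    1# * x           ≡⟨ cong (_* x) (sym (x⁻¹*x≡1 c≢0)) ⟩
    (c ⁻¹ * c) * x   ≡⟨ *-assoc _ _ _ ⟩
    c ⁻¹ * (c * x)   ≡⟨ cong (c ⁻¹ *_) eq ⟩
    c ⁻¹ * (c * y)   ≡⟨ sym (*-assoc _ _ _) ⟩
    (c ⁻¹ * c) * y   ≡⟨ cong (_* y) (x⁻¹*x≡1 c≢0) ⟩
    1# * y           ≡⟨ *-identityˡ y ⟩
    y                ∎

  zero-product : ∀ {x y} → x * y ≡ 0# → x ≢ 0# → y ≡ 0#
  zero-product {x} eq x≢0 = *-cancelˡ x≢0 (trans eq (sym (zeroʳ x)))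

  *-nonzero : ∀ {x y} → x ≢ 0# → y ≢ 0# → x * y ≢ 0#
  *-nonzero x≢0 y≢0 eq = y≢0 (zero-product eq x≢0)

  ⁻¹-unique : ∀ {x y} → x * y ≡ 1# → y ≡ x ⁻¹
  ⁻¹-unique {x} {y} eq with x ≟ 0#
  ... | yes refl = ⊥-elim (0≢1 (trans (sym (zeroˡ y)) eq))
  ... | no x≢0   = *-cancelˡ x≢0 (trans eq (sym (⁻¹-inverse x x≢0)))

  ⁻¹-nonzero : ∀ {x} → x ≢ 0# → x ⁻¹ ≢ 0#
  ⁻¹-nonzero {x} x≢0 eq =
    1≢0 (trans (sym (⁻¹-inverse x x≢0)) (trans (cong (x *_) eq) (zeroʳ x)))

  ⁻¹-involutive : ∀ x → (x ⁻¹) ⁻¹ ≡ x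
  ⁻¹-involutive x with x ≟ 0#
  ... | yes refl = trans (cong _⁻¹ ⁻¹-zero) ⁻¹-zero
  ... | no x≢0   = sym (⁻¹-unique (x⁻¹*x≡1 x≢0))

  ⁻¹-injective : ∀ {x y} → x ⁻¹ ≡ y ⁻¹ → x ≡ y
  ⁻¹-injective {x} {y} eq =
    trans (sym (⁻¹-involutive x)) (trans (cong _⁻¹ eq) (⁻¹-involutive y))

  ⁻¹-distrib-* : ∀ {x y} → x ≢ 0# → y ≢ 0# → (x * y) ⁻¹ ≡ x ⁻¹ * y ⁻¹
  ⁻¹-distrib-* {x} {y} x≢0 y≢0 = sym (⁻¹-unique (begin
    (x * y) * (x ⁻¹ * y ⁻¹)
      ≡⟨ solve 4 (λ a b c d → (a :* b) :* (c :* d) := (a :* c) :* (b :* d)) refl x y (x ⁻¹) (y ⁻¹) ⟩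
    (x * x ⁻¹) * (y * y ⁻¹)  ≡⟨ cong₂ _*_ (⁻¹-inverse x x≢0) (⁻¹-inverse y y≢0) ⟩
    1# * 1#                  ≡⟨ *-identityˡ 1# ⟩
    1#                       ∎))

  ⁻¹-distrib-neg : ∀ x → (- x) ⁻¹ ≡ - (x ⁻¹)
  ⁻¹-distrib-neg x with x ≟ 0#
  ... | yes refl = begin
    (- 0#) ⁻¹   ≡⟨ cong _⁻¹ -0#≈0# ⟩
    0# ⁻¹       ≡⟨ ⁻¹-zero ⟩
    0#          ≡⟨ sym -0#≈0# ⟩
    - 0#        ≡⟨ cong -_ (sym ⁻¹-zero) ⟩
    - (0# ⁻¹)   ∎
  ... | no x≢0 = sym (⁻¹-unique (begin
    (- x) * (- x ⁻¹)  ≡⟨ solve 2 (λ a b → (:- a) :* (:- b) := a :* b) refl x (x ⁻¹) ⟩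
    x * x ⁻¹          ≡⟨ ⁻¹-inverse x x≢0 ⟩
    1#                ∎))

  cross-multiply : ∀ {a b c d} → b ≢ 0# → d ≢ 0# → a * b ⁻¹ ≡ c * d ⁻¹ → a * d ≡ c * b
  cross-multiply {a} {b} {c} {d} b≢0 d≢0 eq = begin
    a * d                  ≡⟨ sym (*-identityʳ _) ⟩
    a * d * 1#             ≡⟨ cong (a * d *_) (sym (⁻¹-inverse b b≢0)) ⟩
    a * d * (b * b ⁻¹)     ≡⟨ solve 4 (λ a b b' d → a :* d :* (b :* b') := (a :* b') :* (b :* d)) refl a b (b ⁻¹) d ⟩
    (a * b ⁻¹) * (b * d)   ≡⟨ cong (_* (b * d)) eq ⟩
    (c * d ⁻¹) * (b * d)   ≡⟨ solve 4 (λ c b d' d → (c :* d') :* (b :* d) := c :* b :* (d :* d')) refl c b (d ⁻¹) d ⟩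
    c * b * (d * d ⁻¹)     ≡⟨ cong (c * b *_) (⁻¹-inverse d d≢0) ⟩
    c * b * 1#             ≡⟨ *-identityʳ _ ⟩
    c * b                  ∎

  *≡-1⇔≡-⁻¹ : ∀ {a m} → m ≢ 0# → (a * m ≡ - 1#) ⇔ (a ≡ - m ⁻¹)
  *≡-1⇔≡-⁻¹ {a} {m} m≢0 = mk⇔ solved checked
    where
    solved : a * m ≡ - 1# → a ≡ - m ⁻¹
    solved am≡-1 = begin
      a                     ≡⟨ sym (*-identityʳ a) ⟩
      a * 1#                ≡⟨ cong (a *_) (sym (⁻¹-inverse m m≢0)) ⟩
      a * (m * m ⁻¹)        ≡⟨ sym (*-assoc a m (m ⁻¹)) ⟩
      a * m * m ⁻¹          ≡⟨ cong (_* m ⁻¹) am≡-1 ⟩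
      - 1# * m ⁻¹           ≡⟨ -1*x≈-x (m ⁻¹) ⟩
      - m ⁻¹                ∎
    checked : a ≡ - m ⁻¹ → a * m ≡ - 1#
    checked refl = begin
      - m ⁻¹ * m            ≡⟨ solve 2 (λ m′ m → :- m′ :* m := :- (m′ :* m)) refl (m ⁻¹) m ⟩
      - (m ⁻¹ * m)          ≡⟨ cong -_ (x⁻¹*x≡1 m≢0) ⟩
      - 1#                  ∎

  char2⇒odd≡1 : nat 2 ≡ 0# → ∀ n → ¬ (2 ∣ n) → nat n ≡ 1#
  char2⇒odd≡1 2≡0 zero 2∤0 = ⊥-elim (2∤0 (divides 0 refl))
  char2⇒odd≡1 2≡0 (suc zero) 2∤1 = refl
  char2⇒odd≡1 2≡0 (suc (suc n)) 2∤n+2 = begin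
    nat (2 ℕ.+ n)      ≡⟨ ×-homo-+ 1# 2 n ⟩
    nat 2 + nat n      ≡⟨ cong (_+ nat n) 2≡0 ⟩
    0# + nat n         ≡⟨ +-identityˡ _ ⟩
    nat n              ≡⟨ char2⇒odd≡1 2≡0 n (λ 2∣n → 2∤n+2 (∣m∣n⇒∣m+n ∣-refl 2∣n)) ⟩
    1#                 ∎

  square-roots : ∀ {x y} → x * x ≡ y * y → x ≡ y ⊎ x ≡ - y
  square-roots {x} {y} eq with (x + - y) ≟ 0#
  ... | yes x-y≡0 = inj₁ (x-y≡0⇒x≡y x-y≡0)
  ... | no  x-y≢0 = inj₂ (x-y≡0⇒x≡y (zero-product factored x-y≢0))
    where
    factored : (x + - y) * (x + - - y) ≡ 0#
    factored = begin
      (x + - y) * (x + - - y)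
        ≡⟨ solve 2 (λ a b → (a :- b) :* (a :- (:- b)) := a :* a :- b :* b) refl x y ⟩
      x * x + - (y * y)  ≡⟨ x≡y⇒x-y≡0 eq ⟩
      0#                 ∎

-- Pigeonhole principle: an injective self-map of Fin n hits every point,
-- for otherwise it would inject Fin n into Fin n minus that point.
injective⇒onto-Fin : ∀ {n} (φ : Fin n → Fin n) → Injective _≡_ _≡_ φ → ∀ y → ∃ λ x → φ x ≡ y
injective⇒onto-Fin {suc n} φ φ-inj y with Fin.any? (λ x → φ x Fin.≟ y)
... | yes hit = hit
... | no miss = ⊥-elim (ℕ.1+n≰n (Fin.injective⇒≤ punchOut-φ-injective))
  where
  φ≢y : ∀ x → y ≢ φ x
  φ≢y x eq = miss (x , sym eq)
  punchOut-φ-injective : Injective _≡_ _≡_ (λ x → punchOut (φ≢y x))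
  punchOut-φ-injective {x} {x′} eq = φ-inj (Fin.punchOut-injective (φ≢y x) (φ≢y x′) eq)

injective⇒permutation : ∀ {n} (φ : Fin n → Fin n) → Injective _≡_ _≡_ φ → Permutation n n
injective⇒permutation φ φ-inj =
  mk↔ₛ′ φ (proj₁ ∘ onto) (proj₂ ∘ onto) (λ x → φ-inj (proj₂ (onto (φ x))))
  where
  onto : ∀ y → ∃ λ x → φ x ≡ y
  onto = injective⇒onto-Fin φ φ-inj

module Finite {A : Set} {n : ℕ} (card : A ↔ Fin n) where
  open Inverse card using (to; from; strictlyInverseˡ; strictlyInverseʳ)

  to-injective : ∀ {x y} → to x ≡ to y → x ≡ y
  to-injective {x} {y} eq =
    trans (sym (strictlyInverseʳ x)) (trans (cong from eq) (strictlyInverseʳ y))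

  transported : (σ : A → A) → Injective _≡_ _≡_ σ → Permutation n n
  transported σ σ-inj = injective⇒permutation (to ∘ σ ∘ from) φ-inj
    where
    φ-inj : Injective _≡_ _≡_ (to ∘ σ ∘ from)
    φ-inj {i} {j} eq = trans (sym (strictlyInverseˡ i))
                        (trans (cong to (σ-inj (to-injective eq))) (strictlyInverseˡ j))

  injective⇒onto : (σ : A → A) → Injective _≡_ _≡_ σ → ∀ y → ∃ λ x → σ x ≡ y
  injective⇒onto σ σ-inj y = from (π ⟨$⟩ˡ to y) , to-injective (Inverse.strictlyInverseˡ π (to y))
    where
    π : Permutation n n
    π = transported σ σ-inj

module FiniteSums (F : Field) {q : ℕ} (card : Field.Carrier F ↔ Fin q) where
  open FieldFacts F
  open Inverse card using (to; from; strictlyInverseˡ; strictlyInverseʳ)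
  open Finite card using (transported)
  open import Algebra.Properties.Semiring.Sum semiring
    using (sum; sum-cong-≗; ∑-distrib-+; *-distribˡ-sum; sum-permute; sum-remove;
           sum-replicate; sum-replicate-zero)
  open ≡-Reasoning

  Σ : (Carrier → Carrier) → Carrier
  Σ g = sum (g ∘ from)

  Σ-cong : ∀ {g h} → (∀ x → g x ≡ h x) → Σ g ≡ Σ h
  Σ-cong eq = sum-cong-≗ (eq ∘ from)

  Σ-+ : ∀ g h → Σ (λ x → g x + h x) ≡ Σ g + Σ h
  Σ-+ g h = ∑-distrib-+ (g ∘ from) (h ∘ from)

  Σ-* : ∀ c g → Σ (λ x → c * g x) ≡ c * Σ g
  Σ-* c g = sym (*-distribˡ-sum c (g ∘ from))

  Σ-neg : ∀ g → Σ (λ x → - g x) ≡ - Σ g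
  Σ-neg g = begin
    Σ (λ x → - g x)       ≡⟨ Σ-cong (λ x → sym (-1*x≈-x (g x))) ⟩
    Σ (λ x → - 1# * g x)  ≡⟨ Σ-* (- 1#) g ⟩
    - 1# * Σ g            ≡⟨ -1*x≈-x _ ⟩
    - Σ g                 ∎

  sum-pointMass : ∀ {n} (t : Fin n → Carrier) i → (∀ j → j ≢ i → t j ≡ 0#) → sum t ≡ t i
  sum-pointMass {suc n} t i vanishes = begin
    sum t                               ≡⟨ sum-remove {i = i} t ⟩
    t i + sum {n} (t ∘ Fin.punchIn i)   ≡⟨ cong (t i +_) (sum-cong-≗ (λ j → vanishes _ (Fin.punchInᵢ≢i i j))) ⟩
    t i + sum {n} (λ _ → 0#)            ≡⟨ cong (t i +_) (sum-replicate-zero n) ⟩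
    t i + 0#                            ≡⟨ +-identityʳ _ ⟩
    t i                                 ∎

  Σ-pointMass : ∀ g x₀ → (∀ x → x ≢ x₀ → g x ≡ 0#) → Σ g ≡ g x₀
  Σ-pointMass g x₀ vanishes =
    trans (sum-pointMass (g ∘ from) (to x₀) vanishes′) (cong g (strictlyInverseʳ x₀))
    where
    vanishes′ : ∀ j → j ≢ to x₀ → g (from j) ≡ 0#
    vanishes′ j j≢ = vanishes (from j) (λ eq → j≢ (trans (sym (strictlyInverseˡ j)) (cong to eq)))

  Σ-reindex : ∀ σ → Injective _≡_ _≡_ σ → ∀ g → Σ (g ∘ σ) ≡ Σ g
  Σ-reindex σ σ-inj g = sym (begin
    Σ g                                     ≡⟨ sum-permute (g ∘ from) (transported σ σ-inj) ⟩
    sum (λ i → g (from (to (σ (from i)))))  ≡⟨ sum-cong-≗ (λ i → cong g (strictlyInverseʳ (σ (from i)))) ⟩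
    Σ (g ∘ σ)                               ∎)

  -- Translation x ↦ x + 1 permutes the field, so constants sum to zero.
  Σ-one : Σ (λ _ → 1#) ≡ 0#
  Σ-one = begin
    Σ (λ _ → 1#)                        ≡⟨ solve 2 (λ a b → b := (a :+ b) :- a) refl (Σ id) _ ⟩
    (Σ id + Σ (λ _ → 1#)) + - Σ id      ≡⟨ cong (_+ - Σ id) (sym (Σ-+ id (λ _ → 1#))) ⟩
    Σ (λ x → x + 1#) + - Σ id           ≡⟨ cong (_+ - Σ id) (Σ-reindex (_+ 1#) +1-injective id) ⟩
    Σ id + - Σ id                       ≡⟨ -‿inverseʳ _ ⟩
    0#                                  ∎
    where
    id : Carrier → Carrier
    id x = x

    +1-injective : Injective _≡_ _≡_ (_+ 1#)
    +1-injective {x} {y} eq = begin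
      x                ≡⟨ solve 2 (λ x o → x := (x :+ o) :- o) refl x 1# ⟩
      (x + 1#) + - 1#  ≡⟨ cong (_+ - 1#) eq ⟩
      (y + 1#) + - 1#  ≡⟨ solve 2 (λ y o → (y :+ o) :- o := y) refl y 1# ⟩
      y                ∎

  Σ-const : ∀ c → Σ (λ _ → c) ≡ 0#
  Σ-const c = begin
    Σ (λ _ → c)        ≡⟨ Σ-cong (λ _ → sym (*-identityʳ c)) ⟩
    Σ (λ _ → c * 1#)   ≡⟨ Σ-* c (λ _ → 1#) ⟩
    c * Σ (λ _ → 1#)   ≡⟨ cong (c *_) Σ-one ⟩
    c * 0#             ≡⟨ zeroʳ c ⟩
    0#                 ∎

  characteristic : nat q ≡ 0#
  characteristic = trans (sym (trans (sum-replicate q) (×ᵤ≈× q 1#))) Σ-one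

  odd-order⇒2≢0 : ¬ (2 ∣ q) → nat 2 ≢ 0#
  odd-order⇒2≢0 2∤q 2≡0 = 1≢0 (trans (sym (char2⇒odd≡1 2≡0 q 2∤q)) characteristic)

  -- When 2 is invertible, odd functions sum to zero (substitute x ↦ -x).
  Σ-odd : nat 2 ≢ 0# → ∀ g → (∀ x → g (- x) ≡ - g x) → Σ g ≡ 0#
  Σ-odd 2≢0 g odd = zero-product twice 2≢0
    where
    neg-injective : Injective _≡_ _≡_ (λ x → - x)
    neg-injective {x} {y} eq = trans (sym (-‿involutive x)) (trans (cong -_ eq) (-‿involutive y))
    twice : nat 2 * Σ g ≡ 0#
    twice = begin
      nat 2 * Σ g                    ≡⟨ solve 1 (λ t → con (ℤ.+ 2) :* t := t :+ t) refl (Σ g) ⟩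
      Σ g + Σ g                      ≡⟨ cong (Σ g +_) (sym (Σ-reindex (λ x → - x) neg-injective g)) ⟩
      Σ g + Σ (λ x → g (- x))        ≡⟨ cong (Σ g +_) (trans (Σ-cong odd) (Σ-neg g)) ⟩
      Σ g + - Σ g                    ≡⟨ -‿inverseʳ _ ⟩
      0#                             ∎

  Σ-reindex-except : ∀ σ → Injective _≡_ _≡_ σ → ∀ g k x₀ →
                     (∀ x → x ≢ x₀ → g (σ x) ≡ k x) →
                     Σ g ≡ Σ k + (g (σ x₀) + - k x₀)
  Σ-reindex-except σ σ-inj g k x₀ agree = begin
    Σ g                                  ≡⟨ sym (Σ-reindex σ σ-inj g) ⟩
    Σ (g ∘ σ)                            ≡⟨ Σ-cong (λ x → solve 2 (λ u v → u := v :+ (u :- v)) refl (g (σ x)) (k x)) ⟩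
    Σ (λ x → k x + defect x)             ≡⟨ Σ-+ k defect ⟩
    Σ k + Σ defect                       ≡⟨ cong (Σ k +_) (Σ-pointMass defect x₀ (λ x x≢x₀ → x≡y⇒x-y≡0 (agree x x≢x₀))) ⟩
    Σ k + (g (σ x₀) + - k x₀)            ∎
    where
    defect : Carrier → Carrier
    defect x = g (σ x) + - k x

-- The map h_a(x) = a x + 2x/(x² - s) on a field in which s is not a square;
-- it is f(X) = aX + 1/(X - r) + 1/(X + r) with r² = s, restricted to F.
module QuadraticMap (F : Field) (s : Field.Carrier F)
                    (nonsquare : ∀ x → Field._*_ F x x ≢ s) where
  open FieldFacts F
  open ≡-Reasoning

  s≢0 : s ≢ 0#
  s≢0 eq = nonsquare 0# (trans (zeroˡ 0#) (sym eq))

  -- D x = x² - s never vanishes on F, so G = 1/D is a genuine inverse.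
  D : Carrier → Carrier
  D x = x * x + - s

  D≢0 : ∀ x → D x ≢ 0#
  D≢0 x eq = nonsquare x (x-y≡0⇒x≡y eq)

  G : Carrier → Carrier
  G x = D x ⁻¹

  D*G≡1 : ∀ x → D x * G x ≡ 1#
  D*G≡1 x = ⁻¹-inverse (D x) (D≢0 x)

  h : Carrier → Carrier → Carrier
  h a x = a * x + nat 2 * x * G x

  -- Clearing denominators in h_a(x) - h_a(y) leaves the factor x - y.
  h-difference : ∀ a x y → (h a x + - h a y) * (D x * D y)
                           ≡ (x + - y) * (a * (D x * D y) + - (nat 2 * (x * y + s)))
  h-difference a x y = begin
    (h a x + - h a y) * (D x * D y)
      ≡⟨ solve 6 (λ a x y s gx gy →
           (a :* x :+ con (ℤ.+ 2) :* x :* gx :- (a :* y :+ con (ℤ.+ 2) :* y :* gy)) :* ((x :* x :- s) :* (y :* y :- s))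
           := a :* (x :- y) :* ((x :* x :- s) :* (y :* y :- s)) :+ con (ℤ.+ 2) :* x :* (y :* y :- s) :* ((x :* x :- s) :* gx)
              :- con (ℤ.+ 2) :* y :* (x :* x :- s) :* ((y :* y :- s) :* gy)) refl a x y s (G x) (G y) ⟩
    a * (x + - y) * (D x * D y) + nat 2 * x * D y * (D x * G x) + - (nat 2 * y * D x * (D y * G y))
      ≡⟨ cong₂ (λ u v → a * (x + - y) * (D x * D y) + nat 2 * x * D y * u + - (nat 2 * y * D x * v)) (D*G≡1 x) (D*G≡1 y) ⟩
    a * (x + - y) * (D x * D y) + nat 2 * x * D y * 1# + - (nat 2 * y * D x * 1#)
      ≡⟨ solve 4 (λ a x y s →
           a :* (x :- y) :* ((x :* x :- s) :* (y :* y :- s)) :+ con (ℤ.+ 2) :* x :* (y :* y :- s) :* con (ℤ.+ 1)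
             :- con (ℤ.+ 2) :* y :* (x :* x :- s) :* con (ℤ.+ 1)
           := (x :- y) :* (a :* ((x :* x :- s) :* (y :* y :- s)) :- con (ℤ.+ 2) :* (x :* y :+ s))) refl a x y s ⟩
    (x + - y) * (a * (D x * D y) + - (nat 2 * (x * y + s))) ∎

  collision : ∀ a {x y} → h a x ≡ h a y → x ≢ y → a * (D x * D y) ≡ nat 2 * (x * y + s)
  collision a {x} {y} eq x≢y = x-y≡0⇒x≡y (zero-product product≡0 (λ e → x≢y (x-y≡0⇒x≡y e)))
    where
    product≡0 : (x + - y) * (a * (D x * D y) + - (nat 2 * (x * y + s))) ≡ 0#
    product≡0 = begin
      _                                 ≡⟨ sym (h-difference a x y) ⟩
      (h a x + - h a y) * (D x * D y)   ≡⟨ cong (_* (D x * D y)) (x≡y⇒x-y≡0 eq) ⟩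
      0# * (D x * D y)                  ≡⟨ zeroˡ _ ⟩
      0#                                ∎

  -- Sufficiency: if 4as = -1, then (xy + 3s)² = s(x - y)² for any
  -- collision, so s would be the square of (xy + 3s)/(x - y).
  h-injective : ∀ a → a * (nat 4 * s) ≡ - 1# → Injective _≡_ _≡_ (h a)
  h-injective a 4as≡-1 {x} {y} eq with x ≟ y
  ... | yes x≡y = x≡y
  ... | no  x≢y = ⊥-elim (nonsquare (W * Z ⁻¹) W/Z-squared)
    where
    W Z : Carrier
    W = x * y + nat 3 * s
    Z = x + - y

    Z≢0 : Z ≢ 0#
    Z≢0 e = x≢y (x-y≡0⇒x≡y e)

    W²≡sZ² : W * W + - (s * (Z * Z)) ≡ 0#
    W²≡sZ² = begin
      W * W + - (s * (Z * Z))
        ≡⟨ solve 3 (λ x y s → (x :* y :+ con (ℤ.+ 3) :* s) :* (x :* y :+ con (ℤ.+ 3) :* s) :- s :* ((x :- y) :* (x :- y))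
             := (x :* x :- s) :* (y :* y :- s) :+ con (ℤ.+ 4) :* s :* (con (ℤ.+ 2) :* (x :* y :+ s))) refl x y s ⟩
      D x * D y + nat 4 * s * (nat 2 * (x * y + s))   ≡⟨ cong (λ u → D x * D y + nat 4 * s * u) (sym (collision a eq x≢y)) ⟩
      D x * D y + nat 4 * s * (a * (D x * D y))
        ≡⟨ solve 3 (λ p a s → p :+ con (ℤ.+ 4) :* s :* (a :* p) := p :+ p :* (a :* (con (ℤ.+ 4) :* s))) refl (D x * D y) a s ⟩
      D x * D y + D x * D y * (a * (nat 4 * s))       ≡⟨ cong (λ u → D x * D y + D x * D y * u) 4as≡-1 ⟩
      D x * D y + D x * D y * - 1#                    ≡⟨ solve 1 (λ p → p :+ p :* (:- con (ℤ.+ 1)) := con (ℤ.+ 0)) refl (D x * D y) ⟩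
      0#                                              ∎

    W/Z-squared : (W * Z ⁻¹) * (W * Z ⁻¹) ≡ s
    W/Z-squared = begin
      (W * Z ⁻¹) * (W * Z ⁻¹)       ≡⟨ solve 2 (λ w z′ → (w :* z′) :* (w :* z′) := (w :* w) :* (z′ :* z′)) refl W (Z ⁻¹) ⟩
      (W * W) * (Z ⁻¹ * Z ⁻¹)       ≡⟨ cong (_* (Z ⁻¹ * Z ⁻¹)) (x-y≡0⇒x≡y W²≡sZ²) ⟩
      (s * (Z * Z)) * (Z ⁻¹ * Z ⁻¹) ≡⟨ solve 3 (λ s z z′ → (s :* (z :* z)) :* (z′ :* z′) := s :* ((z :* z′) :* (z :* z′))) refl s Z (Z ⁻¹) ⟩
      s * ((Z * Z ⁻¹) * (Z * Z ⁻¹)) ≡⟨ cong (λ u → s * (u * u)) (⁻¹-inverse Z Z≢0) ⟩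
      s * (1# * 1#)                 ≡⟨ cong (s *_) (*-identityˡ 1#) ⟩
      s * 1#                        ≡⟨ *-identityʳ s ⟩
      s                             ∎

-- If h_a permutes F then Σ h_a(x)² = Σ x².  Expanding h_a(x)² expresses
-- the left side through T₁ = Σ G(x) and T₂ = Σ G(x)², G = 1/(x² - s);
-- these are evaluated by the substitutions x ↦ s/x and x ↦ (x+s)/(x+1),
-- which transform x² - s into a multiple of itself.
module PowerSums (F : Field) {q : ℕ} (card : Field.Carrier F ↔ Fin q)
                 (s : Field.Carrier F) (nonsquare : ∀ x → Field._*_ F x x ≢ s)
                 (2≢0 : FieldSolver.nat F 2 ≢ Field.0# F) where
  open FieldFacts F
  open FiniteSums F card
  open QuadraticMap F s nonsquare
  open ≡-Reasoning

  x²G≡1+sG : ∀ x → x * x * G x ≡ 1# + s * G x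
  x²G≡1+sG x = begin
    x * x * G x             ≡⟨ solve 3 (λ x s g → x :* x :* g := (x :* x :- s) :* g :+ s :* g) refl x s (G x) ⟩
    D x * G x + s * G x     ≡⟨ cong (_+ s * G x) (D*G≡1 x) ⟩
    1# + s * G x            ∎

  G-even : ∀ x → G (- x) ≡ G x
  G-even x = cong _⁻¹ (solve 2 (λ x s → (:- x) :* (:- x) :- s := x :* x :- s) refl x s)

  G0 : G 0# ≡ - s ⁻¹
  G0 = trans (cong _⁻¹ (solve 1 (λ s → con (ℤ.+ 0) :* con (ℤ.+ 0) :- s := :- s) refl s)) (⁻¹-distrib-neg s)

  T₁ T₂ : Carrier
  T₁ = Σ G
  T₂ = Σ (λ x → G x * G x)

  -- The substitution x ↦ s/x (with 0 ↦ 0) is injective, and for x ≠ 0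
  -- it satisfies (s/x)² - s = -(s/x²)(x² - s).
  inversion : Carrier → Carrier
  inversion x = s * x ⁻¹

  inversion-injective : Injective _≡_ _≡_ inversion
  inversion-injective eq = ⁻¹-injective (*-cancelˡ s≢0 eq)

  G∘inversion : ∀ x → x ≢ 0# → G (inversion x) ≡ - s ⁻¹ + - G x
  G∘inversion x x≢0 = begin
    G (s * x′)                              ≡⟨ cong _⁻¹ D-inverted ⟩
    (- (s * (x′ * x′) * D x)) ⁻¹            ≡⟨ ⁻¹-distrib-neg _ ⟩
    - ((s * (x′ * x′) * D x) ⁻¹)            ≡⟨ cong -_ (⁻¹-distrib-* (*-nonzero s≢0 (*-nonzero x′≢0 x′≢0)) (D≢0 x)) ⟩
    - ((s * (x′ * x′)) ⁻¹ * G x)            ≡⟨ cong (λ u → - (u * G x)) (⁻¹-distrib-* s≢0 (*-nonzero x′≢0 x′≢0)) ⟩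
    - (s ⁻¹ * (x′ * x′) ⁻¹ * G x)           ≡⟨ cong (λ u → - (s ⁻¹ * u * G x)) (⁻¹-distrib-* x′≢0 x′≢0) ⟩
    - (s ⁻¹ * (x′ ⁻¹ * x′ ⁻¹) * G x)        ≡⟨ cong (λ u → - (s ⁻¹ * (u * u) * G x)) (⁻¹-involutive x) ⟩
    - (s ⁻¹ * (x * x) * G x)                ≡⟨ cong -_ (*-assoc _ _ _) ⟩
    - (s ⁻¹ * (x * x * G x))                ≡⟨ cong (λ u → - (s ⁻¹ * u)) (x²G≡1+sG x) ⟩
    - (s ⁻¹ * (1# + s * G x))
      ≡⟨ solve 3 (λ s′ s g → :- (s′ :* (con (ℤ.+ 1) :+ s :* g)) := :- s′ :- (s′ :* s) :* g) refl (s ⁻¹) s (G x) ⟩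
    - s ⁻¹ + - ((s ⁻¹ * s) * G x)           ≡⟨ cong (λ u → - s ⁻¹ + - (u * G x)) (x⁻¹*x≡1 s≢0) ⟩
    - s ⁻¹ + - (1# * G x)                   ≡⟨ cong (λ u → - s ⁻¹ + - u) (*-identityˡ _) ⟩
    - s ⁻¹ + - G x                          ∎
    where
    x′ : Carrier
    x′ = x ⁻¹
    x′≢0 : x′ ≢ 0#
    x′≢0 = ⁻¹-nonzero x≢0
    D-inverted : D (s * x′) ≡ - (s * (x′ * x′) * D x)
    D-inverted = begin
      D (s * x′)                                     ≡⟨ cong (λ u → s * x′ * (s * x′) + - u) (sym (trans (cong (s *_) (*-identityˡ 1#)) (*-identityʳ s))) ⟩
      s * x′ * (s * x′) + - (s * (1# * 1#))          ≡⟨ cong (λ u → s * x′ * (s * x′) + - (s * (u * u))) (sym (⁻¹-inverse x x≢0)) ⟩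
      s * x′ * (s * x′) + - (s * ((x * x′) * (x * x′)))
        ≡⟨ solve 3 (λ s x x′ → s :* x′ :* (s :* x′) :- s :* ((x :* x′) :* (x :* x′)) := :- (s :* (x′ :* x′) :* (x :* x :- s))) refl s x x′ ⟩
      - (s * (x′ * x′) * D x)                        ∎

  -- T₁ = Σ G(s/x) = Σ (-1/s - G x) + defect at 0 = -T₁ - 1/s.
  2sT₁≡-1 : nat 2 * s * T₁ ≡ - 1#
  2sT₁≡-1 = begin
    nat 2 * s * T₁           ≡⟨ solve 2 (λ s t → con (ℤ.+ 2) :* s :* t := s :* (t :- (:- t))) refl s T₁ ⟩
    s * (T₁ + - (- T₁))      ≡⟨ cong (λ u → s * (T₁ + - u)) (sym Σk≡-T₁) ⟩
    s * (T₁ + - Σ k)         ≡⟨ cong (λ u → s * (u + - Σ k)) (Σ-reindex-except inversion inversion-injective G k 0# G∘inversion) ⟩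
    s * (Σ k + (G (inversion 0#) + - k 0#) + - Σ k)
      ≡⟨ cong (λ u → s * (Σ k + (G u + - k 0#) + - Σ k)) (trans (cong (s *_) ⁻¹-zero) (zeroʳ s)) ⟩
    s * (Σ k + (G 0# + - (- s ⁻¹ + - G 0#)) + - Σ k)
      ≡⟨ cong (λ g → s * (Σ k + (g + - (- s ⁻¹ + - g)) + - Σ k)) G0 ⟩
    s * (Σ k + (- s ⁻¹ + - (- s ⁻¹ + - - s ⁻¹)) + - Σ k)
      ≡⟨ solve 3 (λ s s′ t → s :* (t :+ (:- s′ :+ :- (:- s′ :+ :- (:- s′))) :- t) := :- (s :* s′)) refl s (s ⁻¹) (Σ k) ⟩
    - (s * s ⁻¹)             ≡⟨ cong -_ (⁻¹-inverse s s≢0) ⟩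
    - 1#                     ∎
    where
    k : Carrier → Carrier
    k x = - s ⁻¹ + - G x
    Σk≡-T₁ : Σ k ≡ - T₁
    Σk≡-T₁ = begin
      Σ k                            ≡⟨ Σ-+ (λ _ → - s ⁻¹) (λ x → - G x) ⟩
      Σ (λ _ → - s ⁻¹) + Σ (λ x → - G x)  ≡⟨ cong₂ _+_ (Σ-const _) (Σ-neg G) ⟩
      0# + - T₁                      ≡⟨ +-identityˡ _ ⟩
      - T₁                           ∎

  -- The Möbius substitution x ↦ (x + s)/(x + 1), completed by -1 ↦ 1, is
  -- a bijection of F; it transforms x² - s into (1 - s)(x² - s)/(x + 1)².
  möbius : Carrier → Carrier
  möbius x with x ≟ (- 1#)
  ... | yes _ = 1#
  ... | no  _ = (x + s) * (x + 1#) ⁻¹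

  möbius-generic : ∀ {x} → x ≢ - 1# → möbius x ≡ (x + s) * (x + 1#) ⁻¹
  möbius-generic {x} x≢-1 with x ≟ (- 1#)
  ... | yes x≡-1 = ⊥-elim (x≢-1 x≡-1)
  ... | no  _    = refl

  möbius-pole : möbius (- 1#) ≡ 1#
  möbius-pole with (- 1#) ≟ (- 1#)
  ... | yes _   = refl
  ... | no  ≢-1 = ⊥-elim (≢-1 refl)

  x+1≢0 : ∀ {x} → x ≢ - 1# → x + 1# ≢ 0#
  x+1≢0 {x} x≢-1 eq = x≢-1 (x-y≡0⇒x≡y (trans (cong (x +_) (-‿involutive 1#)) eq))

  D1≢0 : D 1# ≢ 0#
  D1≢0 = D≢0 1#

  -- Away from the pole, möbius x ≠ 1 (else s = 1 would be a square).
  möbius-generic≢1 : ∀ {x} → x ≢ - 1# → (x + s) * (x + 1#) ⁻¹ ≢ 1#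
  möbius-generic≢1 {x} x≢-1 eq = nonsquare 1# (begin
    1# * 1#                  ≡⟨ *-identityˡ 1# ⟩
    1#                       ≡⟨ solve 2 (λ x s → con (ℤ.+ 1) := (x :+ con (ℤ.+ 1)) :- x) refl x s ⟩
    (x + 1#) + - x           ≡⟨ cong (_+ - x) x+1≡x+s ⟩
    (x + s) + - x            ≡⟨ solve 2 (λ x s → (x :+ s) :- x := s) refl x s ⟩
    s                        ∎)
    where
    x+1≡x+s : x + 1# ≡ x + s
    x+1≡x+s = sym (trans (sym (*-identityʳ _))
                (trans (cross-multiply (x+1≢0 x≢-1) 1≢0 (trans eq (sym (⁻¹-inverse 1# 1≢0))))
                       (*-identityˡ _)))

  möbius-injective : Injective _≡_ _≡_ möbius
  möbius-injective {x} {y} eq with x ≟ (- 1#) | y ≟ (- 1#)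
  ... | yes x≡-1 | yes y≡-1 = trans x≡-1 (sym y≡-1)
  ... | yes _    | no y≢-1  = ⊥-elim (möbius-generic≢1 y≢-1 (sym eq))
  ... | no x≢-1  | yes _    = ⊥-elim (möbius-generic≢1 x≢-1 eq)
  ... | no x≢-1  | no y≢-1  = x-y≡0⇒x≡y (zero-product (trans (*-comm _ _) difference) D1≢0)
    where
    crossed : (x + s) * (y + 1#) ≡ (y + s) * (x + 1#)
    crossed = cross-multiply (x+1≢0 x≢-1) (x+1≢0 y≢-1) eq
    difference : (x + - y) * D 1# ≡ 0#
    difference = begin
      (x + - y) * D 1#
        ≡⟨ solve 3 (λ x y s → (x :- y) :* (con (ℤ.+ 1) :* con (ℤ.+ 1) :- s)
                := (x :+ s) :* (y :+ con (ℤ.+ 1)) :- (y :+ s) :* (x :+ con (ℤ.+ 1))) refl x y s ⟩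
      (x + s) * (y + 1#) + - ((y + s) * (x + 1#))  ≡⟨ x≡y⇒x-y≡0 crossed ⟩
      0#                                           ∎

  G∘möbius : ∀ x → x ≢ - 1# → G (möbius x) ≡ (x + 1#) * (x + 1#) * (D 1# ⁻¹ * G x)
  G∘möbius x x≢-1 = begin
    G (möbius x)                          ≡⟨ cong G (möbius-generic x≢-1) ⟩
    G ((x + s) * w)                       ≡⟨ cong _⁻¹ D-transformed ⟩
    ((w * w) * (D 1# * D x)) ⁻¹           ≡⟨ ⁻¹-distrib-* (*-nonzero w≢0 w≢0) (*-nonzero D1≢0 (D≢0 x)) ⟩
    (w * w) ⁻¹ * (D 1# * D x) ⁻¹          ≡⟨ cong₂ _*_ (⁻¹-distrib-* w≢0 w≢0) (⁻¹-distrib-* D1≢0 (D≢0 x)) ⟩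
    (w ⁻¹ * w ⁻¹) * (D 1# ⁻¹ * G x)       ≡⟨ cong (λ u → (u * u) * (D 1# ⁻¹ * G x)) (⁻¹-involutive (x + 1#)) ⟩
    (x + 1#) * (x + 1#) * (D 1# ⁻¹ * G x) ∎
    where
    w : Carrier
    w = (x + 1#) ⁻¹
    w≢0 : w ≢ 0#
    w≢0 = ⁻¹-nonzero (x+1≢0 x≢-1)
    D-transformed : D ((x + s) * w) ≡ (w * w) * (D 1# * D x)
    D-transformed = begin
      D ((x + s) * w)
        ≡⟨ cong (λ u → (x + s) * w * ((x + s) * w) + - u) (sym (trans (cong (s *_) (*-identityˡ 1#)) (*-identityʳ s))) ⟩
      (x + s) * w * ((x + s) * w) + - (s * (1# * 1#))
        ≡⟨ cong (λ u → (x + s) * w * ((x + s) * w) + - (s * (u * u))) (sym (⁻¹-inverse (x + 1#) (x+1≢0 x≢-1))) ⟩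
      (x + s) * w * ((x + s) * w) + - (s * (((x + 1#) * w) * ((x + 1#) * w)))
        ≡⟨ solve 3 (λ x s w → (x :+ s) :* w :* ((x :+ s) :* w) :- s :* (((x :+ con (ℤ.+ 1)) :* w) :* ((x :+ con (ℤ.+ 1)) :* w))
              := (w :* w) :* ((con (ℤ.+ 1) :* con (ℤ.+ 1) :- s) :* (x :* x :- s))) refl x s w ⟩
      (w * w) * (D 1# * D x) ∎

  -- Ψ(x) = (x + 1)⁴ G(x)², the image of G² under the Möbius substitution
  -- up to the constant (1 - s)².  Writing x² = (x² - s) + s splits it into
  -- a polynomial in G plus an odd function of x.
  Ψ : Carrier → Carrier
  Ψ x = (x + 1#) * (x + 1#) * ((x + 1#) * (x + 1#)) * (G x * G x)

  A B : Carrier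
  A = nat 2 * s + nat 6
  B = s * s + nat 6 * s + 1#

  oddPart : Carrier → Carrier
  oddPart x = (nat 4 * (x * x * x) + nat 4 * x) * (G x * G x)

  oddPart-odd : ∀ x → oddPart (- x) ≡ - oddPart x
  oddPart-odd x = begin
    oddPart (- x)
      ≡⟨ cong (λ g → (nat 4 * ((- x) * (- x) * (- x)) + nat 4 * (- x)) * (g * g)) (G-even x) ⟩
    (nat 4 * ((- x) * (- x) * (- x)) + nat 4 * (- x)) * (G x * G x)
      ≡⟨ solve 2 (λ x g → (con (ℤ.+ 4) :* ((:- x) :* (:- x) :* (:- x)) :+ con (ℤ.+ 4) :* (:- x)) :* (g :* g)
            := :- ((con (ℤ.+ 4) :* (x :* x :* x) :+ con (ℤ.+ 4) :* x) :* (g :* g))) refl x (G x) ⟩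
    - oddPart x ∎

  Ψ-expansion : ∀ x → Ψ x ≡ 1# + A * G x + B * (G x * G x) + oddPart x
  Ψ-expansion x = begin
    Ψ x
      ≡⟨ solve 3 (λ x s g → (x :+ con (ℤ.+ 1)) :* (x :+ con (ℤ.+ 1)) :* ((x :+ con (ℤ.+ 1)) :* (x :+ con (ℤ.+ 1))) :* (g :* g)
            := con (ℤ.+ 1) :+ (con (ℤ.+ 2) :* s :+ con (ℤ.+ 6)) :* g :+ (s :* s :+ con (ℤ.+ 6) :* s :+ con (ℤ.+ 1)) :* (g :* g)
               :+ (con (ℤ.+ 4) :* (x :* x :* x) :+ con (ℤ.+ 4) :* x) :* (g :* g)
               :+ ((x :* x :- s) :* g :- con (ℤ.+ 1)) :* (g :* (x :* x :+ s :+ con (ℤ.+ 6)) :+ con (ℤ.+ 1))) refl x s (G x) ⟩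
    expansion + (D x * G x + - 1#) * c   ≡⟨ cong (λ u → expansion + (u + - 1#) * c) (D*G≡1 x) ⟩
    expansion + (1# + - 1#) * c          ≡⟨ cong (λ u → expansion + u * c) (-‿inverseʳ 1#) ⟩
    expansion + 0# * c                   ≡⟨ cong (expansion +_) (zeroˡ c) ⟩
    expansion + 0#                       ≡⟨ +-identityʳ _ ⟩
    expansion                            ∎
    where
    expansion c : Carrier
    expansion = 1# + A * G x + B * (G x * G x) + oddPart x
    c = G x * (x * x + s + nat 6) + 1#

  Σ-Ψ : Σ Ψ ≡ A * T₁ + B * T₂
  Σ-Ψ = begin
    Σ Ψ                                  ≡⟨ Σ-cong Ψ-expansion ⟩
    Σ (λ x → even x + oddPart x)         ≡⟨ Σ-+ even oddPart ⟩
    Σ even + Σ oddPart                   ≡⟨ cong (Σ even +_) (Σ-odd 2≢0 oddPart oddPart-odd) ⟩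
    Σ even + 0#                          ≡⟨ +-identityʳ _ ⟩
    Σ even                               ≡⟨ Σ-+ (λ x → 1# + A * G x) (λ x → B * (G x * G x)) ⟩
    Σ (λ x → 1# + A * G x) + Σ (λ x → B * (G x * G x))
      ≡⟨ cong₂ _+_ (Σ-+ (λ _ → 1#) (λ x → A * G x)) (Σ-* B (λ x → G x * G x)) ⟩
    Σ (λ _ → 1#) + Σ (λ x → A * G x) + B * T₂
      ≡⟨ cong₂ (λ u v → u + v + B * T₂) Σ-one (Σ-* A G) ⟩
    0# + A * T₁ + B * T₂                 ≡⟨ cong (_+ B * T₂) (+-identityˡ _) ⟩
    A * T₁ + B * T₂                      ∎
    where
    even : Carrier → Carrier
    even x = 1# + A * G x + B * (G x * G x)

  -- Σ (1 - s)² G² = Σ Ψ + defect at the pole x = -1, where Ψ vanishes.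
  möbius-relation : D 1# * D 1# * T₂ ≡ A * T₁ + B * T₂ + 1#
  möbius-relation = begin
    D 1# * D 1# * T₂                     ≡⟨ sym (Σ-* (D 1# * D 1#) (λ x → G x * G x)) ⟩
    Σ g                                  ≡⟨ Σ-reindex-except möbius möbius-injective g Ψ (- 1#) g∘möbius ⟩
    Σ Ψ + (g (möbius (- 1#)) + - Ψ (- 1#))
      ≡⟨ cong₂ (λ u v → u + (g v + - Ψ (- 1#))) Σ-Ψ möbius-pole ⟩
    A * T₁ + B * T₂ + (g 1# + - Ψ (- 1#))
      ≡⟨ cong (λ z → A * T₁ + B * T₂ + (g 1# + - (z * z * (z * z) * (G (- 1#) * G (- 1#))))) (-‿inverseˡ 1#) ⟩
    A * T₁ + B * T₂ + (g 1# + - (0# * 0# * (0# * 0#) * (G (- 1#) * G (- 1#))))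
      ≡⟨ cong (A * T₁ + B * T₂ +_) (solve 3 (λ d g g′ → d :* d :* (g :* g) :- (con (ℤ.+ 0) :* con (ℤ.+ 0) :* (con (ℤ.+ 0) :* con (ℤ.+ 0)) :* (g′ :* g′))
                                           := (d :* g) :* (d :* g)) refl (D 1#) (G 1#) (G (- 1#))) ⟩
    A * T₁ + B * T₂ + (D 1# * G 1#) * (D 1# * G 1#)
      ≡⟨ cong (λ u → A * T₁ + B * T₂ + u * u) (D*G≡1 1#) ⟩
    A * T₁ + B * T₂ + 1# * 1#            ≡⟨ cong (A * T₁ + B * T₂ +_) (*-identityˡ 1#) ⟩
    A * T₁ + B * T₂ + 1#                 ∎
    where
    g : Carrier → Carrier
    g y = D 1# * D 1# * (G y * G y)
    g∘möbius : ∀ x → x ≢ - 1# → g (möbius x) ≡ Ψ x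
    g∘möbius x x≢-1 = begin
      D 1# * D 1# * (G (möbius x) * G (möbius x))          ≡⟨ cong (λ u → D 1# * D 1# * (u * u)) (G∘möbius x x≢-1) ⟩
      D 1# * D 1# * ((p * (D 1# ⁻¹ * G x)) * (p * (D 1# ⁻¹ * G x)))
        ≡⟨ solve 4 (λ p d d′ g → d :* d :* ((p :* (d′ :* g)) :* (p :* (d′ :* g))) := p :* p :* (g :* g) :* ((d :* d′) :* (d :* d′))) refl p (D 1#) (D 1# ⁻¹) (G x) ⟩
      p * p * (G x * G x) * ((D 1# * D 1# ⁻¹) * (D 1# * D 1# ⁻¹))
        ≡⟨ cong (λ u → p * p * (G x * G x) * (u * u)) (⁻¹-inverse (D 1#) D1≢0) ⟩
      p * p * (G x * G x) * (1# * 1#)      ≡⟨ cong (p * p * (G x * G x) *_) (*-identityˡ 1#) ⟩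
      p * p * (G x * G x) * 1#             ≡⟨ *-identityʳ _ ⟩
      Ψ x                                  ∎
      where
      p : Carrier
      p = (x + 1#) * (x + 1#)

  8s²T₂≡3 : nat 8 * s * s * T₂ ≡ nat 3
  8s²T₂≡3 = begin
    nat 8 * s * s * T₂
      ≡⟨ solve 3 (λ s t₁ t₂ → con (ℤ.+ 8) :* s :* s :* t₂
            := (:- s) :* ((con (ℤ.+ 1) :* con (ℤ.+ 1) :- s) :* (con (ℤ.+ 1) :* con (ℤ.+ 1) :- s) :* t₂
                   :- ((con (ℤ.+ 2) :* s :+ con (ℤ.+ 6)) :* t₁ :+ (s :* s :+ con (ℤ.+ 6) :* s :+ con (ℤ.+ 1)) :* t₂ :+ con (ℤ.+ 1)))
               :- (s :+ con (ℤ.+ 3)) :* (con (ℤ.+ 2) :* s :* t₁ :+ con (ℤ.+ 1)) :+ con (ℤ.+ 3)) refl s T₁ T₂ ⟩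
    (- s) * (D 1# * D 1# * T₂ + - (A * T₁ + B * T₂ + 1#)) + - ((s + nat 3) * (nat 2 * s * T₁ + 1#)) + nat 3
      ≡⟨ cong₂ (λ u v → (- s) * u + - ((s + nat 3) * (v + 1#)) + nat 3) (x≡y⇒x-y≡0 möbius-relation) 2sT₁≡-1 ⟩
    (- s) * 0# + - ((s + nat 3) * (- 1# + 1#)) + nat 3
      ≡⟨ solve 1 (λ s → (:- s) :* con (ℤ.+ 0) :- (s :+ con (ℤ.+ 3)) :* (:- con (ℤ.+ 1) :+ con (ℤ.+ 1)) :+ con (ℤ.+ 3) := con (ℤ.+ 3)) refl s ⟩
    nat 3 ∎

  Σx² : Carrier
  Σx² = Σ (λ x → x * x)

  -- For a ≠ 0, x ↦ ax permutes F, so Σ (ax)² = Σ x².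
  a²Σx²≡Σx² : ∀ {a} → a ≢ 0# → a * a * Σx² ≡ Σx²
  a²Σx²≡Σx² {a} a≢0 = begin
    a * a * Σx²                   ≡⟨ sym (Σ-* (a * a) (λ x → x * x)) ⟩
    Σ (λ x → a * a * (x * x))     ≡⟨ Σ-cong (λ x → solve 2 (λ a x → a :* a :* (x :* x) := (a :* x) :* (a :* x)) refl a x) ⟩
    Σ (λ x → (a * x) * (a * x))   ≡⟨ Σ-reindex (a *_) (*-cancelˡ a≢0) (λ y → y * y) ⟩
    Σx²                           ∎

  -- The G-part of h_a(x)², using x² G(x) = 1 + s G(x).
  Gpart : Carrier → Carrier → Carrier
  Gpart a x = (nat 4 * a * s + nat 4) * G x + nat 4 * s * (G x * G x)

  h²-expansion : ∀ a x → h a x * h a x ≡ a * a * (x * x) + (nat 4 * a + Gpart a x)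
  h²-expansion a x = begin
    h a x * h a x
      ≡⟨ solve 3 (λ a x g → (a :* x :+ con (ℤ.+ 2) :* x :* g) :* (a :* x :+ con (ℤ.+ 2) :* x :* g)
            := a :* a :* (x :* x) :+ con (ℤ.+ 4) :* a :* (x :* x :* g) :+ con (ℤ.+ 4) :* (x :* x :* g) :* g) refl a x (G x) ⟩
    a * a * (x * x) + nat 4 * a * (x * x * G x) + nat 4 * (x * x * G x) * G x
      ≡⟨ cong (λ u → a * a * (x * x) + nat 4 * a * u + nat 4 * u * G x) (x²G≡1+sG x) ⟩
    a * a * (x * x) + nat 4 * a * (1# + s * G x) + nat 4 * (1# + s * G x) * G x
      ≡⟨ solve 4 (λ a x s g → a :* a :* (x :* x) :+ con (ℤ.+ 4) :* a :* (con (ℤ.+ 1) :+ s :* g) :+ con (ℤ.+ 4) :* (con (ℤ.+ 1) :+ s :* g) :* g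
            := a :* a :* (x :* x) :+ (con (ℤ.+ 4) :* a :+ ((con (ℤ.+ 4) :* a :* s :+ con (ℤ.+ 4)) :* g :+ con (ℤ.+ 4) :* s :* (g :* g)))) refl a x s (G x) ⟩
    a * a * (x * x) + (nat 4 * a + Gpart a x) ∎

  ΣGpart : ∀ a → Σ (Gpart a) ≡ (nat 4 * a * s + nat 4) * T₁ + nat 4 * s * T₂
  ΣGpart a = trans (Σ-+ (λ x → (nat 4 * a * s + nat 4) * G x) (λ x → nat 4 * s * (G x * G x)))
                   (cong₂ _+_ (Σ-* _ G) (Σ-* (nat 4 * s) (λ x → G x * G x)))

  Σh² : ∀ a → Σ (λ x → h a x * h a x) ≡ a * a * Σx² + Σ (Gpart a)
  Σh² a = begin
    Σ (λ x → h a x * h a x)                               ≡⟨ Σ-cong (h²-expansion a) ⟩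
    Σ (λ x → a * a * (x * x) + (nat 4 * a + Gpart a x))   ≡⟨ Σ-+ (λ x → a * a * (x * x)) (λ x → nat 4 * a + Gpart a x) ⟩
    Σ (λ x → a * a * (x * x)) + Σ (λ x → nat 4 * a + Gpart a x)
      ≡⟨ cong₂ _+_ (Σ-* (a * a) (λ x → x * x)) (Σ-+ (λ _ → nat 4 * a) (Gpart a)) ⟩
    a * a * Σx² + (Σ (λ _ → nat 4 * a) + Σ (Gpart a))    ≡⟨ cong (λ u → a * a * Σx² + (u + Σ (Gpart a))) (Σ-const _) ⟩
    a * a * Σx² + (0# + Σ (Gpart a))                      ≡⟨ cong (a * a * Σx² +_) (+-identityˡ _) ⟩
    a * a * Σx² + Σ (Gpart a)                             ∎

  -- If h_a permutes F then Σ h_a(x)² = Σ x² = Σ (ax)², so the G-part sums to 0.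
  injective⇒ΣGpart≡0 : ∀ a → a ≢ 0# → Injective _≡_ _≡_ (h a) → Σ (Gpart a) ≡ 0#
  injective⇒ΣGpart≡0 a a≢0 h-inj = begin
    Σ (Gpart a)                        ≡⟨ solve 2 (λ m t → m := (t :+ m) :- t) refl (Σ (Gpart a)) Σx² ⟩
    (Σx² + Σ (Gpart a)) + - Σx²        ≡⟨ cong (λ u → (u + Σ (Gpart a)) + - Σx²) (sym (a²Σx²≡Σx² a≢0)) ⟩
    (a * a * Σx² + Σ (Gpart a)) + - Σx² ≡⟨ cong (_+ - Σx²) (sym (Σh² a)) ⟩
    Σ (λ x → h a x * h a x) + - Σx²    ≡⟨ cong (_+ - Σx²) (Σ-reindex (h a) h-inj (λ y → y * y)) ⟩
    Σx² + - Σx²                        ≡⟨ -‿inverseʳ _ ⟩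
    0#                                 ∎

  -- Necessity: with 2sT₁ = -1 and 8s²T₂ = 3, the vanishing of
  -- (4as + 4) T₁ + 4s T₂ is equivalent to 4as = -1.
  h-injective⇒4as≡-1 : ∀ a → a ≢ 0# → Injective _≡_ _≡_ (h a) → a * (nat 4 * s) ≡ - 1#
  h-injective⇒4as≡-1 a a≢0 h-inj = x-y≡0⇒x≡y (begin
    a * (nat 4 * s) + - (- 1#)
      ≡⟨ solve 4 (λ a s t₁ t₂ → a :* (con (ℤ.+ 4) :* s) :- (:- con (ℤ.+ 1))
           := (:- (con (ℤ.+ 2) :* s)) :* ((con (ℤ.+ 4) :* a :* s :+ con (ℤ.+ 4)) :* t₁ :+ con (ℤ.+ 4) :* s :* t₂)
              :+ (con (ℤ.+ 4) :* a :* s :+ con (ℤ.+ 4)) :* (con (ℤ.+ 2) :* s :* t₁ :+ con (ℤ.+ 1))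
              :+ (con (ℤ.+ 8) :* s :* s :* t₂ :- con (ℤ.+ 3))) refl a s T₁ T₂ ⟩
    (- (nat 2 * s)) * M + c₄ * (nat 2 * s * T₁ + 1#) + (nat 8 * s * s * T₂ + - nat 3)
      ≡⟨ cong (λ u → (- (nat 2 * s)) * u + c₄ * (nat 2 * s * T₁ + 1#) + (nat 8 * s * s * T₂ + - nat 3)) M≡0 ⟩
    (- (nat 2 * s)) * 0# + c₄ * (nat 2 * s * T₁ + 1#) + (nat 8 * s * s * T₂ + - nat 3)
      ≡⟨ cong₂ (λ v w → (- (nat 2 * s)) * 0# + c₄ * (v + 1#) + (w + - nat 3)) 2sT₁≡-1 8s²T₂≡3 ⟩
    (- (nat 2 * s)) * 0# + c₄ * (- 1# + 1#) + (nat 3 + - nat 3)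
      ≡⟨ solve 2 (λ c s → (:- (con (ℤ.+ 2) :* s)) :* con (ℤ.+ 0) :+ c :* (:- con (ℤ.+ 1) :+ con (ℤ.+ 1))
                         :+ (con (ℤ.+ 3) :- con (ℤ.+ 3)) := con (ℤ.+ 0)) refl c₄ s ⟩
    0# ∎)
    where
    c₄ M : Carrier
    c₄ = nat 4 * a * s + nat 4
    M = c₄ * T₁ + nat 4 * s * T₂
    M≡0 : M ≡ 0#
    M≡0 = trans (sym (ΣGpart a)) (injective⇒ΣGpart≡0 a a≢0 h-inj)

module EmbeddingFacts {q₁ q₂ : ℕ} {K : FiniteField q₁} {L : FiniteField q₂}
                      (emb : Embedding K L) where
  module K = FieldFacts (FiniteField.field′ K)
  open FieldFacts (FiniteField.field′ L)
  open Embedding emb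
  open ≡-Reasoning

  ι-0 : ι K.0# ≡ 0#
  ι-0 = begin
    ι K.0#                            ≡⟨ solve 1 (λ u → u := (u :+ u) :- u) refl (ι K.0#) ⟩
    ι K.0# + ι K.0# + - ι K.0#        ≡⟨ cong (_+ - ι K.0#) (sym (ι-+ K.0# K.0#)) ⟩
    ι (K.0# K.+ K.0#) + - ι K.0#      ≡⟨ cong (λ u → ι u + - ι K.0#) (K.+-identityˡ K.0#) ⟩
    ι K.0# + - ι K.0#                 ≡⟨ -‿inverseʳ _ ⟩
    0#                                ∎

  ι-neg : ∀ x → ι (K.- x) ≡ - ι x
  ι-neg x = begin
    ι (K.- x)                    ≡⟨ solve 2 (λ u v → u := (u :+ v) :- v) refl (ι (K.- x)) (ι x) ⟩
    ι (K.- x) + ι x + - ι x      ≡⟨ cong (_+ - ι x) (sym (ι-+ (K.- x) x)) ⟩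
    ι (K.- x K.+ x) + - ι x      ≡⟨ cong (λ w → ι w + - ι x) (K.-‿inverseˡ x) ⟩
    ι K.0# + - ι x               ≡⟨ cong (_+ - ι x) ι-0 ⟩
    0# + - ι x                   ≡⟨ +-identityˡ _ ⟩
    - ι x                        ∎

  ι-nat : ∀ n → ι (K.nat n) ≡ nat n
  ι-nat zero    = ι-0
  ι-nat (suc n) = begin
    ι (K.nat (suc n))         ≡⟨ cong ι (K.nat-suc n) ⟩
    ι (K.1# K.+ K.nat n)      ≡⟨ ι-+ K.1# (K.nat n) ⟩
    ι K.1# + ι (K.nat n)      ≡⟨ cong₂ _+_ ι-1 (ι-nat n) ⟩
    1# + nat n                ≡⟨ sym (nat-suc n) ⟩
    nat (suc n)               ∎

  ι-nonzero : ∀ {x} → x ≢ K.0# → ι x ≢ 0#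
  ι-nonzero {x} x≢0 ιx≡0 = 1≢0 (begin
    1#                    ≡⟨ sym ι-1 ⟩
    ι K.1#                ≡⟨ cong ι (sym (K.⁻¹-inverse x x≢0)) ⟩
    ι (x K.* x K.⁻¹)      ≡⟨ ι-* x (x K.⁻¹) ⟩
    ι x * ι (x K.⁻¹)      ≡⟨ cong (_* ι (x K.⁻¹)) ιx≡0 ⟩
    0# * ι (x K.⁻¹)       ≡⟨ zeroˡ _ ⟩
    0#                    ∎)

  ι-injective : ∀ {x y} → ι x ≡ ι y → x ≡ y
  ι-injective {x} {y} eq with (x K.+ K.- y) K.≟ K.0#
  ... | yes x-y≡0 = K.x-y≡0⇒x≡y x-y≡0
  ... | no  x-y≢0 = ⊥-elim (ι-nonzero x-y≢0 (begin
    ι (x K.+ K.- y)    ≡⟨ ι-+ x (K.- y) ⟩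
    ι x + ι (K.- y)    ≡⟨ cong (ι x +_) (ι-neg y) ⟩
    ι x + - ι y        ≡⟨ x≡y⇒x-y≡0 eq ⟩
    0#                 ∎))

  ι-⁻¹ : ∀ x → ι (x K.⁻¹) ≡ (ι x) ⁻¹
  ι-⁻¹ x with x K.≟ K.0#
  ... | yes refl = begin
    ι (K.0# K.⁻¹)   ≡⟨ cong ι K.⁻¹-zero ⟩
    ι K.0#          ≡⟨ ι-0 ⟩
    0#              ≡⟨ sym ⁻¹-zero ⟩
    0# ⁻¹           ≡⟨ cong _⁻¹ (sym ι-0) ⟩
    (ι K.0#) ⁻¹     ∎
  ... | no x≢0 = ⁻¹-unique (trans (sym (ι-* x (x K.⁻¹))) (trans (cong ι (K.⁻¹-inverse x x≢0)) ι-1))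

  -- If r ∉ K but r² = c ∈ K, then c is not a square in K: its square
  -- roots in L are ±r.
  nonsquare : ∀ {r c} → (∀ x → ι x ≢ r) → r * r ≡ ι c → ∀ x → x K.* x ≢ c
  nonsquare {r} {c} r∉K r²≡c x x²≡c with square-roots (trans r²≡c (trans (cong ι (sym x²≡c)) (ι-* x x)))
  ... | inj₁ r≡x  = r∉K x (sym r≡x)
  ... | inj₂ r≡-x = r∉K (K.- x) (trans (ι-neg x) (sym r≡-x))

module PolyEval (F : Field) where
  open FieldFacts F
  open Poly F
  open ≡-Reasoning

  eval-+ₚ : ∀ p p′ y → eval (p +ₚ p′) y ≡ eval p y + eval p′ y
  eval-+ₚ []      p′       y = sym (+-identityˡ _)
  eval-+ₚ (a ∷ p) []       y = sym (+-identityʳ _)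
  eval-+ₚ (a ∷ p) (b ∷ p′) y = begin
    (a + b) + y * eval (p +ₚ p′) y         ≡⟨ cong (λ u → (a + b) + y * u) (eval-+ₚ p p′ y) ⟩
    (a + b) + y * (eval p y + eval p′ y)
      ≡⟨ solve 5 (λ a b y u v → (a :+ b) :+ y :* (u :+ v) := (a :+ y :* u) :+ (b :+ y :* v)) refl a b y (eval p y) (eval p′ y) ⟩
    (a + y * eval p y) + (b + y * eval p′ y) ∎

  eval-scale : ∀ c p y → eval (map (c *_) p) y ≡ c * eval p y
  eval-scale c []      y = sym (zeroʳ c)
  eval-scale c (a ∷ p) y = begin
    c * a + y * eval (map (c *_) p) y   ≡⟨ cong (λ u → c * a + y * u) (eval-scale c p y) ⟩
    c * a + y * (c * eval p y)
      ≡⟨ solve 4 (λ c a y u → c :* a :+ y :* (c :* u) := c :* (a :+ y :* u)) refl c a y (eval p y) ⟩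
    c * (a + y * eval p y)              ∎

  eval-*ₚ : ∀ p p′ y → eval (p *ₚ p′) y ≡ eval p y * eval p′ y
  eval-*ₚ []      p′ y = sym (zeroˡ _)
  eval-*ₚ (a ∷ p) p′ y = begin
    eval (map (a *_) p′ +ₚ (0# ∷ (p *ₚ p′))) y          ≡⟨ eval-+ₚ (map (a *_) p′) (0# ∷ (p *ₚ p′)) y ⟩
    eval (map (a *_) p′) y + (0# + y * eval (p *ₚ p′) y)
      ≡⟨ cong₂ (λ u v → u + (0# + y * v)) (eval-scale a p′ y) (eval-*ₚ p p′ y) ⟩
    a * eval p′ y + (0# + y * (eval p y * eval p′ y))
      ≡⟨ solve 4 (λ a y u v → a :* v :+ (con (ℤ.+ 0) :+ y :* (u :* v)) := (a :+ y :* u) :* v) refl a y (eval p y) (eval p′ y) ⟩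
    (a + y * eval p y) * eval p′ y                       ∎

  dropZeros-nonzero : ∀ c cs → c ≢ 0# → length (dropZeros (c ∷ cs)) ≡ suc (length cs)
  dropZeros-nonzero c cs c≢0 with c ≟ 0#
  ... | yes c≡0 = ⊥-elim (c≢0 c≡0)
  ... | no  _   = refl

-- A map of P¹(L) that restricts to g on K and fixes ∞ is a permutation
-- rational function of P¹(K) exactly when g is injective (K is finite).
module ProjectiveLine {q : ℕ} (K : FiniteField q) (L : FiniteField (q ℕ.* q))
                      (emb : Embedding K L) where
  open ThmDefs K L emb
  open Embedding emb
  open EmbeddingFacts emb using (ι-injective)
  private module K = FiniteField K

  ιP¹-injective : Injective _≡_ _≡_ ιP¹
  ιP¹-injective {nothing} {nothing} _  = refl
  ιP¹-injective {just x}  {just y}  eq = cong just (ι-injective (just-injective eq))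

  Maybe-map-injective : ∀ {g : K.Carrier → K.Carrier} → Injective _≡_ _≡_ g →
                        Injective _≡_ _≡_ (Maybe.map g)
  Maybe-map-injective g-inj {nothing} {nothing} _  = refl
  Maybe-map-injective g-inj {just x}  {just y}  eq = cong just (g-inj (just-injective eq))

  permutation⇔injective : ∀ φ (g : K.Carrier → K.Carrier) →
                          (∀ x → φ (just (ι x)) ≡ just (ι (g x))) → φ ∞ ≡ ∞ →
                          IsPermutationOfP¹K φ ⇔ Injective _≡_ _≡_ g
  permutation⇔injective φ g φ∘ι≡ι∘g φ∞≡∞ = mk⇔ restriction-injective extension-bijective
    where
    restriction-injective : IsPermutationOfP¹K φ → Injective _≡_ _≡_ g
    restriction-injective (g′ , φ∘ιP¹≡ιP¹∘g′ , g′-inj , _) {x} {y} gx≡gy =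
      just-injective (g′-inj (ιP¹-injective (begin
        ιP¹ (g′ (just x))     ≡⟨ sym (φ∘ιP¹≡ιP¹∘g′ (just x)) ⟩
        φ (just (ι x))        ≡⟨ φ∘ι≡ι∘g x ⟩
        just (ι (g x))        ≡⟨ cong (just ∘ ι) gx≡gy ⟩
        just (ι (g y))        ≡⟨ sym (φ∘ι≡ι∘g y) ⟩
        φ (just (ι y))        ≡⟨ φ∘ιP¹≡ιP¹∘g′ (just y) ⟩
        ιP¹ (g′ (just y))     ∎)))
      where open ≡-Reasoning

    extension-bijective : Injective _≡_ _≡_ g → IsPermutationOfP¹K φ
    extension-bijective g-inj = Maybe.map g , commutes , Maybe-map-injective g-inj , onto
      where
      commutes : ∀ x → φ (ιP¹ x) ≡ ιP¹ (Maybe.map g x)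
      commutes nothing  = φ∞≡∞
      commutes (just x) = φ∘ι≡ι∘g x
      preimage : ∀ y → ∃ λ x → g x ≡ y
      preimage = Finite.injective⇒onto K.cardinality g g-inj
      onto : Surjective _≡_ _≡_ (Maybe.map g)
      onto nothing  = nothing , λ { refl → refl }
      onto (just y) = just (proj₁ (preimage y)) , λ { refl → cong just (proj₂ (preimage y)) }

-- The rational function f(X) = aX + 1/(X - r) + 1/(X + r) of the theorem,
-- where r² = c ∈ K is a nonsquare: on K it equals h_a for s = c (as
-- x² - r² never vanishes there), and it fixes ∞ since deg P > deg Q.
module RationalFunction {q : ℕ} (K : FiniteField q) (L : FiniteField (q ℕ.* q))
                        (emb : Embedding K L) (a : FiniteField.Carrier K)
                        (a≢0 : a ≢ FiniteField.0# K) (r : FiniteField.Carrier L)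
                        (c : FiniteField.Carrier K) (r²≡c : FiniteField._*_ L r r ≡ Embedding.ι emb c)
                        (c-nonsquare : ∀ x → FiniteField._*_ K x x ≢ c) where
  open ThmDefs K L emb
  open Embedding emb
  open EmbeddingFacts emb
  open FieldFacts (FiniteField.field′ L)
  open Poly (FiniteField.field′ L) using (Pol; eval; size; Xₚ; const; _+ₚ_; _*ₚ_)
  open PolyEval (FiniteField.field′ L)
  open QuadraticMap (FiniteField.field′ K) c c-nonsquare using (s≢0; D; D≢0; G; h)
  open ≡-Reasoning

  eval-fDen : ∀ y → eval (fDen r) y ≡ y * y + - (r * r)
  eval-fDen y = trans (eval-*ₚ (- r ∷ 1# ∷ []) (r ∷ 1# ∷ []) y)
    (solve 2 (λ r y → (:- r :+ y :* (con (ℤ.+ 1) :+ y :* con (ℤ.+ 0))) :* (r :+ y :* (con (ℤ.+ 1) :+ y :* con (ℤ.+ 0)))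
                      := y :* y :- r :* r) refl r y)

  eval-fNum : ∀ y → eval (fNum a r) y ≡ ι a * y * (y * y + - (r * r)) + (y + y)
  eval-fNum y = begin
    eval (aXQ +ₚ (r ∷ 1# ∷ []) +ₚ (- r ∷ 1# ∷ [])) y
      ≡⟨ eval-+ₚ (aXQ +ₚ (r ∷ 1# ∷ [])) (- r ∷ 1# ∷ []) y ⟩
    eval (aXQ +ₚ (r ∷ 1# ∷ [])) y + eval (- r ∷ 1# ∷ []) y
      ≡⟨ cong (_+ eval (- r ∷ 1# ∷ []) y) (eval-+ₚ aXQ (r ∷ 1# ∷ []) y) ⟩
    eval aXQ y + eval (r ∷ 1# ∷ []) y + eval (- r ∷ 1# ∷ []) y
      ≡⟨ cong (λ u → u + eval (r ∷ 1# ∷ []) y + eval (- r ∷ 1# ∷ []) y)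
              (trans (eval-*ₚ (const (ι a) *ₚ Xₚ) (fDen r) y)
                     (cong₂ _*_ (eval-*ₚ (const (ι a)) Xₚ y) (eval-fDen y))) ⟩
    eval (const (ι a)) y * eval Xₚ y * (y * y + - (r * r)) + eval (r ∷ 1# ∷ []) y + eval (- r ∷ 1# ∷ []) y
      ≡⟨ solve 3 (λ α r y → (α :+ y :* con (ℤ.+ 0)) :* (con (ℤ.+ 0) :+ y :* (con (ℤ.+ 1) :+ y :* con (ℤ.+ 0))) :* (y :* y :- r :* r)
              :+ (r :+ y :* (con (ℤ.+ 1) :+ y :* con (ℤ.+ 0))) :+ (:- r :+ y :* (con (ℤ.+ 1) :+ y :* con (ℤ.+ 0)))
              := α :* y :* (y :* y :- r :* r) :+ (y :+ y)) refl (ι a) r y ⟩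
    ι a * y * (y * y + - (r * r)) + (y + y) ∎
    where
    aXQ : Pol
    aXQ = const (ι a) *ₚ Xₚ *ₚ fDen r

  ι∘D : ∀ x → ι (D x) ≡ ι x * ι x + - (r * r)
  ι∘D x = begin
    ι (x K.* x K.+ K.- c)       ≡⟨ ι-+ (x K.* x) (K.- c) ⟩
    ι (x K.* x) + ι (K.- c)     ≡⟨ cong₂ _+_ (ι-* x x) (ι-neg c) ⟩
    ι x * ι x + - ι c           ≡⟨ cong (λ u → ι x * ι x + - u) (sym r²≡c) ⟩
    ι x * ι x + - (r * r)       ∎

  ι∘h : ∀ x → ι (h a x) ≡ ι a * ι x + nat 2 * ι x * (ι x * ι x + - (r * r)) ⁻¹
  ι∘h x = begin
    ι (a K.* x K.+ K.nat 2 K.* x K.* G x)              ≡⟨ ι-+ _ _ ⟩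
    ι (a K.* x) + ι (K.nat 2 K.* x K.* G x)
      ≡⟨ cong₂ _+_ (ι-* a x) (trans (ι-* _ _) (cong₂ _*_ (ι-* _ _) (ι-⁻¹ (D x)))) ⟩
    ι a * ι x + ι (K.nat 2) * ι x * (ι (D x)) ⁻¹
      ≡⟨ cong₂ (λ u v → ι a * ι x + u * ι x * v ⁻¹) (ι-nat 2) (ι∘D x) ⟩
    ι a * ι x + nat 2 * ι x * (ι x * ι x + - (r * r)) ⁻¹ ∎

  f-on-K : ∀ x → f a r (just (ι x)) ≡ just (ι (h a x))
  f-on-K x with eval (fDen r) (ι x) ≟ 0#
  ... | yes Q≡0 = ⊥-elim (ι-nonzero (D≢0 x) (trans (ι∘D x) (trans (sym (eval-fDen (ι x))) Q≡0)))
  ... | no  Q≢0 = cong just (begin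
    eval (fNum a r) y * eval (fDen r) y ⁻¹     ≡⟨ cong₂ (λ u v → u * v ⁻¹) (eval-fNum y) (eval-fDen y) ⟩
    (ι a * y * E + (y + y)) * E ⁻¹
      ≡⟨ solve 4 (λ α y e e′ → (α :* y :* e :+ (y :+ y)) :* e′ := α :* y :* (e :* e′) :+ con (ℤ.+ 2) :* y :* e′) refl (ι a) y E (E ⁻¹) ⟩
    ι a * y * (E * E ⁻¹) + nat 2 * y * E ⁻¹   ≡⟨ cong (λ u → ι a * y * u + nat 2 * y * E ⁻¹) (⁻¹-inverse E E≢0) ⟩
    ι a * y * 1# + nat 2 * y * E ⁻¹           ≡⟨ cong (_+ nat 2 * y * E ⁻¹) (*-identityʳ _) ⟩
    ι a * y + nat 2 * y * E ⁻¹                ≡⟨ sym (ι∘h x) ⟩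
    ι (h a x)                                  ∎)
    where
    y E : Carrier
    y = ι x
    E = y * y + - (r * r)
    E≢0 : E ≢ 0#
    E≢0 e = Q≢0 (trans (eval-fDen y) e)

  -- The denominator has degree 2 and the numerator degree 3 (leading
  -- coefficient a ≠ 0), so f(∞) = ∞.
  size-fDen : size (fDen r) ≡ 3
  size-fDen = dropZeros-nonzero (1# * 1#) _ (λ e → 1≢0 (trans (sym (*-identityˡ 1#)) e))

  size-fNum : size (fNum a r) ≡ 4
  size-fNum = dropZeros-nonzero ((ι a * 1#) * (1# * 1#)) _ (λ e → ι-nonzero a≢0 (trans ιa≡lead e))
    where
    ιa≡lead : ι a ≡ (ι a * 1#) * (1# * 1#)
    ιa≡lead = solve 1 (λ α → α := (α :* con (ℤ.+ 1)) :* (con (ℤ.+ 1) :* con (ℤ.+ 1))) refl (ι a)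

  f-at-∞ : f a r ∞ ≡ ∞
  f-at-∞ rewrite size-fDen | size-fNum = refl

  condition-in-K : K.nat 2 ≢ K.0# →
                   (a K.* (K.nat 4 K.* c) ≡ K.- K.1#) ⇔ (ι a ≡ - (four * (r * r)) ⁻¹)
  condition-in-K 2≢0 = mk⇔ (λ a≡ → trans (cong ι a≡) ι-condition) (λ ιa≡ → ι-injective (trans ιa≡ (sym ι-condition)))
                         ⇔-∘ K.*≡-1⇔≡-⁻¹ 4c≢0
    where
    4c≢0 : K.nat 4 K.* c ≢ K.0#
    4c≢0 = K.*-nonzero (λ e → K.*-nonzero 2≢0 2≢0 (trans (sym (K.×1-homo-* 2 2)) e)) s≢0
    ι-condition : ι (K.- (K.nat 4 K.* c) K.⁻¹) ≡ - (four * (r * r)) ⁻¹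
    ι-condition = begin
      ι (K.- (K.nat 4 K.* c) K.⁻¹)      ≡⟨ ι-neg _ ⟩
      - ι ((K.nat 4 K.* c) K.⁻¹)        ≡⟨ cong -_ (ι-⁻¹ _) ⟩
      - (ι (K.nat 4 K.* c)) ⁻¹          ≡⟨ cong (λ u → - u ⁻¹) (ι-* _ _) ⟩
      - (ι (K.nat 4) * ι c) ⁻¹          ≡⟨ cong₂ (λ u v → - (u * v) ⁻¹) (ι-nat 4) (sym r²≡c) ⟩
      - (four * (r * r)) ⁻¹             ∎

odd-power : ∀ p k → ¬ (2 ∣ p) → ¬ (2 ∣ p ^ k)
odd-power p zero    2∤p 2∣1 with () ← ∣1⇒≡1 2∣1
odd-power p (suc k) 2∤p 2∣p·pᵏ =
  Sum.[ 2∤p , odd-power p k 2∤p ] (euclidsLemma p (p ^ k) prime[2] 2∣p·pᵏ)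

theorem3p4 : (q p k : ℕ) → Prime p → ¬ (2 ∣ p) → 1 ≤ k → q ≡ p ^ k →
    (K : FiniteField q) (L : FiniteField (q ℕ.* q)) (emb : Embedding K L) →
    (a : FiniteField.Carrier K) → a ≢ FiniteField.0# K →
    (r : FiniteField.Carrier L) →
    (∀ c → Embedding.ι emb c ≢ r) →
    (∃ λ c → FiniteField._*_ L r r ≡ Embedding.ι emb c) →
    ThmDefs.IsPermutationOfP¹K K L emb (ThmDefs.f K L emb a r)
      ⇔ (Embedding.ι emb a
          ≡ FiniteField.-_ L (FiniteField._⁻¹ L
              (FiniteField._*_ L (ThmDefs.four K L emb) (FiniteField._*_ L r r))))
-- f permutes P¹(K) ⇔ h_a is injective on K ⇔ 4ac = -1 ⇔ ι a = -1/(4r²).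
theorem3p4 q p k _ 2∤p _ q≡pᵏ K L emb a a≢0 r r∉K (c , r²≡c) =
  condition-in-K 2≢0 ⇔-∘ (h-injective⇔condition ⇔-∘ f-permutation⇔h-injective)
  where
  module K = FiniteField K

  c-nonsquare : ∀ x → x K.* x ≢ c
  c-nonsquare = EmbeddingFacts.nonsquare emb r∉K r²≡c

  open RationalFunction K L emb a a≢0 r c r²≡c c-nonsquare
  open QuadraticMap K.field′ c c-nonsquare using (h; h-injective)
  open FieldSolver K.field′ using (nat)

  2≢0 : nat 2 ≢ K.0#
  2≢0 = FiniteSums.odd-order⇒2≢0 K.field′ K.cardinality
          (subst (λ n → ¬ (2 ∣ n)) (sym q≡pᵏ) (odd-power p k 2∤p))

  f-permutation⇔h-injective : ThmDefs.IsPermutationOfP¹K K L emb (ThmDefs.f K L emb a r) ⇔ Injective _≡_ _≡_ (h a)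
  f-permutation⇔h-injective = ProjectiveLine.permutation⇔injective K L emb (ThmDefs.f K L emb a r) (h a) f-on-K f-at-∞

  h-injective⇔condition : Injective _≡_ _≡_ (h a) ⇔ (a K.* (nat 4 K.* c) ≡ K.- K.1#)
  h-injective⇔condition =
    mk⇔ (PowerSums.h-injective⇒4as≡-1 K.field′ K.cardinality c c-nonsquare 2≢0 a a≢0) (h-injective a)
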